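{- Let $q$ be a prime power, $F=GF(q)$, $E=GF(q^n)$. Let $m$ be a positive divisor of $Q$ and $f,g$ monic divisors of $x^n-1$ in $F[x]$. Let $r\ge1$ and let $(m_1,f_1,g_1),\ldots,(m_r,f_r,g_r)$ be triples with $m_i\mid m$, $f_i\mid f$, $g_i\mid g$ (monic), and let $(m_0,f_0,g_0)$ be a triple of such divisors, such that: the primes dividing $\mathrm{lcm}\{m_1,\ldots,m_r\}$ are exactly those dividing $m$; the monic irreducibles dividing $\mathrm{lcm}\{f_1,\ldots,f_r\}$ are exactly those dividing $f$; the monic irreducibles dividing $\mathrm{lcm}\{g_1,\ldots,g_r\}$ are exactly those dividing $g$; and for every $i\ne j$ the primes dividing $\gcd(m_i,m_j)$ are exactly those dividing $m_0$, and the irreducibles dividing $\gcd(f_i,f_j)$, resp. $\gcd(g_i,g_j)$, are exactly those dividing $f_0$, resp. $g_0$. Then \[N(m,f,g)\ge\sum_{i=1}^rN(m_i,f_i,g_i)-(r-1)N(m_0,f_0,g_0).\]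
   Context: $Q$ denotes the radical of $\frac{q^n-1}{(q-1)\gcd(n,q-1)}$. For $m\mid q^n-1$, $w\in E^*$ is $m$-free if $w=v^d$ with $v\in E$, $d\mid m$ implies $d=1$. For monic $H=\sum a_ix^i\in F[x]$, $H^\sigma(v)=\sum a_iv^{q^i}$; for a monic divisor $g$ of $x^n-1$, $w\in E$ is $g$-free if $w=H^\sigma(v)$ with $v\in E$, $H$ a monic divisor of $g$, implies $H=1$. $N(m,f,g)$ is the number of $w\in E^*$ that are $m$-free and $f$-free with $w^{ -1}$ $g$-free. (The paper writes the third argument as a divisor of $y^n-1$ to distinguish it notationally; this is only a change of variable name.) -}

module Defs where

open import Level using (0ℓ)
open import Function using (_∘_)
open import Function.Bundles using (_⇔_)
open import Data.Nat as ℕ using (ℕ; zero; suc; _≤_; _∸_)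
open import Data.Nat.Divisibility using (_∣_; _∤_)
open import Data.Nat.Primality using (Prime)
open import Data.Nat.LCM using (lcm)
open import Data.Integer as ℤ using (ℤ)
open import Data.Fin using (Fin)
import Data.Fin as Fin
open import Data.List using (List; []; _∷_; _++_; [_]; length; map; replicate)
open import Data.List.Membership.Propositional using (_∈_)
open import Data.List.Relation.Unary.Unique.Propositional using (Unique)
open import Data.Product using (Σ; ∃; _×_)
open import Data.Sum using (_⊎_)
open import Relation.Binary.PropositionalEquality using (_≡_; _≢_)
open import Algebra.Structures using (IsCommutativeRing)

IsPrimePower : ℕ → Set
IsPrimePower q = Σ ℕ λ p → Σ ℕ λ k → Prime p × 1 ≤ k × q ≡ p ℕ.^ k

IsRadical : ℕ → ℕ → Set
IsRadical Q K = (∀ p → Prime p → (p ℕ.* p) ∤ Q)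
              × (∀ p → Prime p → (p ∣ Q ⇔ p ∣ K))

lcmᶠ : ∀ {r} → (Fin r → ℕ) → ℕ
lcmᶠ {zero}  _  = 1
lcmᶠ {suc r} ms = lcm (ms Fin.zero) (lcmᶠ (ms ∘ Fin.suc))

sumᶠ : ∀ {r} → (Fin r → ℕ) → ℤ
sumᶠ {zero}  _  = ℤ.+ 0
sumᶠ {suc r} ns = ℤ.+ (ns Fin.zero) ℤ.+ sumᶠ (ns ∘ Fin.suc)

record FiniteField : Set₁ where
  infixl 7 _*_
  infixl 6 _+_
  field
    Carrier  : Set
    _+_ _*_  : Carrier → Carrier → Carrier
    -_       : Carrier → Carrier
    0# 1#    : Carrier
    _⁻¹      : Carrier → Carrier
    isCommutativeRing : IsCommutativeRing _≡_ _+_ _*_ -_ 0# 1#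
    0≢1      : 0# ≢ 1#
    inverseʳ : ∀ x → x ≢ 0# → x * (x ⁻¹) ≡ 1#
    elements          : List Carrier
    elements-unique   : Unique elements
    elements-complete : ∀ x → x ∈ elements

  card : ℕ
  card = length elements

  _^_ : Carrier → ℕ → Carrier
  x ^ zero  = 1#
  x ^ suc k = x * (x ^ k)

open FiniteField public using (card)

-- A field embedding F ↪ E (a unital ring homomorphism; automatically injective)
record Embedding (F E : FiniteField) : Set where
  module F = FiniteField F
  module E = FiniteField E
  field
    ι     : F.Carrier → E.Carrier
    ι-+   : ∀ a b → ι (a F.+ b) ≡ ι a E.+ ι b
    ι-*   : ∀ a b → ι (a F.* b) ≡ ι a E.* ι b
    ι-1   : ι F.1# ≡ E.1#

-- A general polynomial is its coefficient list a₀ ∷ a₁ ∷ … (lowest degree first).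
-- A MONIC polynomial x^d + a_{d-1}x^{d-1} + … + a₀ is represented by the list
-- of its lower coefficients a₀ ∷ … ∷ a_{d-1}; this representation is canonical.

module Poly (F : FiniteField) where
  open FiniteField F hiding (card)

  Coeffs : Set
  Coeffs = List Carrier

  Monic : Set
  Monic = List Carrier

  toPoly : Monic → Coeffs
  toPoly h = h ++ [ 1# ]

  one : Monic
  one = []

  padd : Coeffs → Coeffs → Coeffs
  padd []       q        = q
  padd (a ∷ p)  []       = a ∷ p
  padd (a ∷ p)  (b ∷ q)  = (a + b) ∷ padd p q

  pmul : Coeffs → Coeffs → Coeffs
  pmul []      q = []
  pmul (a ∷ p) q = padd (map (a *_) q) (0# ∷ pmul p q)

  _∣ₘ_ : Monic → Monic → Set
  f ∣ₘ g = Σ Monic λ h → pmul (toPoly f) (toPoly h) ≡ toPoly g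

  xⁿ-1 : ℕ → Monic
  xⁿ-1 zero    = []          -- unused: the theorem assumes n ≥ 1
  xⁿ-1 (suc k) = (- 1#) ∷ replicate k 0#

  Irreducible : Monic → Set
  Irreducible P = P ≢ one × (∀ D → D ∣ₘ P → D ≡ one ⊎ D ≡ P)

  IsLcm : ∀ {r} → (Fin r → Monic) → Monic → Set
  IsLcm fs L = (∀ i → fs i ∣ₘ L) × (∀ M → (∀ i → fs i ∣ₘ M) → L ∣ₘ M)

  IsGcd : Monic → Monic → Monic → Set
  IsGcd a b G = G ∣ₘ a × G ∣ₘ b × (∀ D → D ∣ₘ a → D ∣ₘ b → D ∣ₘ G)

module Free {F E : FiniteField} (emb : Embedding F E) where
  open Embedding emb using (ι)
  open FiniteField E hiding (card)
  open Poly F using (Monic; toPoly; one; _∣ₘ_)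

  q : ℕ
  q = FiniteField.card F

  -- H^σ(v) = Σ aᵢ v^{q^i}  for H = Σ aᵢ xⁱ (full coefficient list)
  σ-eval : ℕ → List (FiniteField.Carrier F) → Carrier → Carrier
  σ-eval i []       v = 0#
  σ-eval i (a ∷ as) v = ι a * (v ^ (q ℕ.^ i)) + σ-eval (suc i) as v

  _ˢ_ : Monic → Carrier → Carrier
  H ˢ v = σ-eval 0 (toPoly H) v

  MFree : ℕ → Carrier → Set
  MFree m w = ∀ (v : Carrier) (d : ℕ) → d ∣ m → w ≡ v ^ d → d ≡ 1

  GFree : Monic → Carrier → Set
  GFree g w = ∀ (v : Carrier) (H : Monic) → H ∣ₘ g → w ≡ H ˢ v → H ≡ one

  Good : ℕ → Monic → Monic → Carrier → Set
  Good m f g w = w ≢ 0# × MFree m w × GFree f w × GFree g (w ⁻¹)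

  IsCount : (Carrier → Set) → ℕ → Set
  IsCount P k = Σ (List Carrier) λ L →
    Unique L × (∀ x → (x ∈ L ⇔ P x)) × length L ≡ k

{-# OPTIONS --safe #-}
module Submission where

-- An element is m-free exactly when it is not a p-th power for any prime p ∣ m, and it is g-free
-- exactly when it is not P^σ(u) for any irreducible P ∣ g: since the q-th power map is a ring
-- endomorphism of E fixing F, H ↦ H^σ turns products of polynomials into composites. So the
-- hypotheses on lcms and gcds make every element good for all (mᵢ, fᵢ, gᵢ) good for (m, f, g),
-- and every element good for some (mᵢ, fᵢ, gᵢ) good for (m₀, f₀, g₀) when r ≥ 2. Summing the
-- pointwise bound Σᵢ [x ∈ Aᵢ] ≤ [x ∈ ⋂ᵢ Aᵢ] + (r − 1)·[x ∈ A₀] over E gives the inequality.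
-- Irreducible factors, lcms and gcds in F[x] come from ideals being generated by a monic element
-- of least degree; this is argued under double negation, which is harmless because the freeness
-- conclusions are decidable.

open import Defs
open import Level using (0ℓ)
open import Function using (_∘_; id; case_of_)
open import Function.Bundles using (_⇔_; Equivalence; mk⇔)
open import Effect.Monad using (RawMonad)
open import Data.Empty using (⊥-elim)
open import Data.Unit using (⊤; tt)
open import Data.Product using (∃-syntax; _×_; _,_; proj₁; proj₂)
open import Data.Sum using (_⊎_; inj₁; inj₂)
open import Data.Nat using (ℕ; zero; suc; _≤_; _<_; z≤n; s≤s; _∸_; _!)
import Data.Nat as ℕ
import Data.Nat.ListAction as ℕ using (product)
import Data.Nat.Properties as ℕ
open import Data.Nat.Induction using (<-rec)
open import Data.Nat.Divisibility using (_∣_; _∤_; divides; ∣1⇒≡1; ∣⇒≤; m∣m*n; ∣-trans; 0∣⇒≡0)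
open import Data.Nat.DivMod using (m/n*n≡m)
open import Data.Nat.GCD using (gcd; gcd[m,n]∣m)
open import Data.Nat.LCM using (gcd*lcm)
open import Data.Nat.Primality using (Prime; euclidsLemma; ¬prime[0]; ¬prime[1])
open import Data.Nat.Primality.Factorisation using (factorise)
open import Data.Nat.Combinatorics using (_C_; nCn≡1; k![n∸k]!∣n!)
open import Data.Nat.Combinatorics.Specification using (nCk≡n!/k![n-k]!)
import Data.Integer as ℤ
import Data.Integer.Properties as ℤ
open import Data.Fin as Fin using (Fin)
import Data.Fin.Properties as Fin
open import Data.Vec.Functional as Vector using (Vector)
open import Data.List using (List; []; _∷_; _++_; length; filter; map; foldr; replicate)
import Data.List.Properties as List
open import Data.List.Relation.Unary.Any using (here; there; index)
import Data.List.Relation.Unary.All as All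
open import Data.List.Relation.Unary.All using (_∷_)
open import Data.List.Relation.Unary.AllPairs using (_∷_)
open import Data.List.Relation.Unary.Unique.Propositional using (Unique)
import Data.List.Relation.Unary.Unique.Propositional.Properties as Unique
open import Data.List.Membership.Propositional using (_∈_; _∉_)
open import Data.List.Membership.Propositional.Properties using (∈-filter⁺; ∈-filter⁻; ∈-map⁺; ∈-map⁻)
open import Data.List.Membership.Propositional.Properties.WithK using (unique∧set⇒bag)
open import Data.List.Membership.Setoid.Properties using (index-injective)
open import Data.List.Relation.Binary.BagAndSetEquality using (∼bag⇒↭)
open import Data.List.Relation.Binary.Permutation.Propositional using (_↭_; ↭⇒↭ₛ)
open import Data.List.Relation.Binary.Permutation.Propositional.Properties using (↭-length)
open import Data.List.Relation.Binary.Permutation.Setoid.Properties using (foldr-commMonoid)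
open import Algebra.Bundles using (CommutativeMonoid; CommutativeRing; Semiring)
open import Algebra.Structures using (IsCommutativeMonoid)
open import Relation.Nullary using (¬_; yes; no; ¬?; decidable-stable)
import Relation.Nullary.Decidable as Dec
open import Relation.Nullary.Negation using (¬¬-Monad; ¬¬-map)
open import Relation.Binary.Bundles using (Setoid)
open import Relation.Binary.Structures using (IsEquivalence)
open import Relation.Binary.Definitions using (DecidableEquality; Tri; tri<; tri≈; tri>)
import Relation.Binary.Reasoning.Setoid as SetoidReasoning
import Relation.Binary.PropositionalEquality as ≡
open import Relation.Binary.PropositionalEquality
  using (_≡_; _≢_; refl; sym; trans; cong; cong₂; subst; subst₂; module ≡-Reasoning)

open RawMonad (¬¬-Monad {0ℓ}) using (_>>=_; pure)

↭-from-members : ∀ {A : Set} {xs ys : List A} → Unique xs → Unique ys →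
                 (∀ {x} → x ∈ xs ⇔ x ∈ ys) → xs ↭ ys
↭-from-members uxs uys same = ∼bag⇒↭ (unique∧set⇒bag uxs uys same)

enumeration⇒decEq : ∀ {A : Set} {xs : List A} → (∀ x → x ∈ xs) → DecidableEquality A
enumeration⇒decEq complete x y = Dec.map′ (index-injective (≡.setoid _) (complete x) (complete y))
  (λ { refl → refl }) (index (complete x) Fin.≟ index (complete y))

foldr-↭ : ∀ {A : Set} {_∙_ : A → A → A} {ε : A} → IsCommutativeMonoid _≡_ _∙_ ε →
          ∀ {xs ys} → xs ↭ ys → foldr _∙_ ε xs ≡ foldr _∙_ ε ys
foldr-↭ isCM xs↭ys = foldr-commMonoid (≡.setoid _) isCM (↭⇒↭ₛ xs↭ys)

¬¬-least : (T : ℕ → Set) → ∀ {n} → T n → ¬ ¬ (∃[ m ] T m × (∀ {k} → k < m → ¬ T k))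
¬¬-least T {n} = <-rec (λ n → T n → ¬ ¬ (∃[ m ] T m × (∀ {k} → k < m → ¬ T k)))
  (λ n smaller Tn no-least → no-least (n , Tn , λ k<n Tk → smaller k<n Tk no-least)) n

¬¬-Π-Fin : ∀ {r} {P : Fin r → Set} → (∀ i → ¬ ¬ P i) → ¬ ¬ (∀ i → P i)
¬¬-Π-Fin {zero}  _   = pure λ ()
¬¬-Π-Fin {suc r} ¬¬P = do
  p₀ ← ¬¬P Fin.zero
  ps ← ¬¬-Π-Fin (¬¬P ∘ Fin.suc)
  pure (Fin.∀-cons p₀ ps)

-- Counting

module Sieve where
  open import Data.Nat using (_+_; _*_)
  open import Algebra.Properties.Semiring.Sum ℕ.+-*-semiring using (sum; ∑-distrib-+; sum-cong-≗; sum-replicate-zero)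

  ∏ : ∀ {n} → Vector ℕ n → ℕ
  ∏ = Vector.foldr _*_ 1

  Bits : ∀ {n} → Vector ℕ n → Set
  Bits a = ∀ i → a i ≤ 1

  ∏-bits≤1 : ∀ {n} (a : Vector ℕ n) → Bits a → ∏ a ≤ 1
  ∏-bits≤1 {zero}  a bits = ℕ.≤-refl
  ∏-bits≤1 {suc n} a bits = ℕ.*-mono-≤ (bits Fin.zero) (∏-bits≤1 (a ∘ Fin.suc) (bits ∘ Fin.suc))

  ∏-bits≤ : ∀ {n} (a : Vector ℕ n) → Bits a → ∀ i → ∏ a ≤ a i
  ∏-bits≤ a bits Fin.zero = begin
    a Fin.zero * ∏ (a ∘ Fin.suc) ≤⟨ ℕ.*-monoʳ-≤ (a Fin.zero) (∏-bits≤1 (a ∘ Fin.suc) (bits ∘ Fin.suc)) ⟩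
    a Fin.zero * 1               ≡⟨ ℕ.*-identityʳ _ ⟩
    a Fin.zero                   ∎
    where open ℕ.≤-Reasoning
  ∏-bits≤ a bits (Fin.suc i) = begin
    a Fin.zero * ∏ (a ∘ Fin.suc) ≤⟨ ℕ.*-monoˡ-≤ (∏ (a ∘ Fin.suc)) (bits Fin.zero) ⟩
    1 * ∏ (a ∘ Fin.suc)          ≡⟨ ℕ.*-identityˡ _ ⟩
    ∏ (a ∘ Fin.suc)              ≤⟨ ∏-bits≤ (a ∘ Fin.suc) (bits ∘ Fin.suc) i ⟩
    a (Fin.suc i)                ∎
    where open ℕ.≤-Reasoning

  x+y≤x*y+c : ∀ {x y c} → x ≤ 1 → x ≤ c → y ≤ c → x + y ≤ x * y + c
  x+y≤x*y+c {zero}     _ _   y≤c = y≤c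
  x+y≤x*y+c {suc zero} {y} {c} _ 1≤c _ = begin
    1 + y       ≡⟨ ℕ.+-comm 1 y ⟩
    y + 1       ≤⟨ ℕ.+-monoʳ-≤ y 1≤c ⟩
    y + c       ≡⟨ cong (_+ c) (sym (ℕ.*-identityˡ y)) ⟩
    1 * y + c   ∎
    where open ℕ.≤-Reasoning
  x+y≤x*y+c {suc (suc _)} (s≤s ()) _ _

  ∑-bits≤∏+ : ∀ {n} (a : Vector ℕ n) {c} → Bits a → (∀ {i j} → i ≢ j → a i ≤ c) →
              sum a ≤ ∏ a + (n ∸ 1) * c
  ∑-bits≤∏+ {zero}        a bits apart = z≤n
  ∑-bits≤∏+ {suc zero}    a bits apart = ℕ.≤-reflexive (cong (_+ 0) (sym (ℕ.*-identityʳ _)))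
  ∑-bits≤∏+ {suc (suc n)} a {c} bits apart = begin
    a₀ + sum a'                ≤⟨ ℕ.+-monoʳ-≤ a₀ (∑-bits≤∏+ a' (bits ∘ Fin.suc) (λ i≢j → apart (i≢j ∘ Fin.suc-injective))) ⟩
    a₀ + (∏ a' + n * c)        ≡⟨ ℕ.+-assoc a₀ _ _ ⟨
    (a₀ + ∏ a') + n * c        ≤⟨ ℕ.+-monoˡ-≤ (n * c) (x+y≤x*y+c (bits Fin.zero) (apart {j = Fin.suc Fin.zero} (λ ())) ∏a'≤c) ⟩
    (a₀ * ∏ a' + c) + n * c    ≡⟨ ℕ.+-assoc (a₀ * ∏ a') c _ ⟩
    a₀ * ∏ a' + (c + n * c)    ∎
    where
    open ℕ.≤-Reasoning
    a₀ = a Fin.zero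
    a' = a ∘ Fin.suc
    ∏a'≤c : ∏ a' ≤ c
    ∏a'≤c = ℕ.≤-trans (∏-bits≤ a' (bits ∘ Fin.suc) Fin.zero) (apart {j = Fin.zero} (λ ()))

  sumᶠ≡+sum : ∀ {r} (ns : Fin r → ℕ) → sumᶠ ns ≡ ℤ.+ sum ns
  sumᶠ≡+sum {zero}  ns = refl
  sumᶠ≡+sum {suc r} ns = trans (cong (ℤ._+_ (ℤ.+ ns Fin.zero)) (sumᶠ≡+sum (ns ∘ Fin.suc))) (sym (ℤ.pos-+ (ns Fin.zero) _))

  module _ {A : Set} (_≟_ : DecidableEquality A) where
    open import Data.List.Membership.DecPropositional _≟_ using (_∈?_)

    𝟙 : List A → A → ℕ
    𝟙 L x with x ∈? L
    ... | yes _ = 1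
    ... | no  _ = 0

    𝟙-∈ : ∀ {L x} → x ∈ L → 𝟙 L x ≡ 1
    𝟙-∈ {L} {x} x∈L with x ∈? L
    ... | yes _   = refl
    ... | no x∉L = ⊥-elim (x∉L x∈L)

    𝟙-∉ : ∀ {L x} → x ∉ L → 𝟙 L x ≡ 0
    𝟙-∉ {L} {x} x∉L with x ∈? L
    ... | yes x∈L = ⊥-elim (x∉L x∈L)
    ... | no _    = refl

    𝟙≤1 : ∀ L x → 𝟙 L x ≤ 1
    𝟙≤1 L x with x ∈? L
    ... | yes _ = ℕ.≤-refl
    ... | no  _ = z≤n

    𝟙-mono : ∀ {L L' x} → (x ∈ L → x ∈ L') → 𝟙 L x ≤ 𝟙 L' x
    𝟙-mono {L} {L'} {x} L⊆L' with x ∈? L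
    ... | yes x∈L = ℕ.≤-reflexive (sym (𝟙-∈ (L⊆L' x∈L)))
    ... | no  _   = z≤n

    count : List A → List A → ℕ
    count L xs = length (filter (_∈? L) xs)

    count-∷ : ∀ L x xs → count L (x ∷ xs) ≡ 𝟙 L x + count L xs
    count-∷ L x xs with x ∈? L
    ... | yes _ = refl
    ... | no  _ = refl

    count-complete : ∀ {L U} → Unique L → Unique U → (∀ x → x ∈ U) → count L U ≡ length L
    count-complete {L} {U} uL uU complete = ↭-length (↭-from-members (Unique.filter⁺ (_∈? L) {U} uU) uL
      (mk⇔ (proj₂ ∘ ∈-filter⁻ (_∈? L) {xs = U}) (∈-filter⁺ (_∈? L) (complete _))))

    module _ {r} (L L₀ : List A) (Ls : Fin r → List A)
             (⋂Ls⊆L : ∀ {x} → (∀ i → x ∈ Ls i) → x ∈ L)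
             (Ls⊆L₀ : ∀ {i j} → i ≢ j → ∀ {x} → x ∈ Ls i → x ∈ L₀) where

      ∏𝟙≤𝟙 : ∀ x → ∏ (λ i → 𝟙 (Ls i) x) ≤ 𝟙 L x
      ∏𝟙≤𝟙 x with x ∈? L
      ... | yes _   = ∏-bits≤1 _ (λ i → 𝟙≤1 (Ls i) x)
      ... | no  x∉L with Fin.¬∀⟶∃¬ r _ (λ i → x ∈? Ls i) (x∉L ∘ ⋂Ls⊆L)
      ...   | j , x∉Lⱼ = ℕ.≤-trans (∏-bits≤ _ (λ i → 𝟙≤1 (Ls i) x) j) (ℕ.≤-reflexive (𝟙-∉ x∉Lⱼ))

      sieve-pointwise : ∀ x → sum (λ i → 𝟙 (Ls i) x) ≤ 𝟙 L x + (r ∸ 1) * 𝟙 L₀ x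
      sieve-pointwise x = ℕ.≤-trans (∑-bits≤∏+ _ (λ i → 𝟙≤1 (Ls i) x) (λ i≢j → 𝟙-mono (Ls⊆L₀ i≢j)))
                                    (ℕ.+-monoˡ-≤ _ (∏𝟙≤𝟙 x))

      sieve : ∀ xs → sum (λ i → count (Ls i) xs) ≤ count L xs + (r ∸ 1) * count L₀ xs
      sieve []       = ℕ.≤-trans (ℕ.≤-reflexive (sum-replicate-zero r)) z≤n
      sieve (x ∷ xs) = begin
        sum (λ i → count (Ls i) (x ∷ xs))                     ≡⟨ sum-cong-≗ (λ i → count-∷ (Ls i) x xs) ⟩
        sum (λ i → 𝟙 (Ls i) x + count (Ls i) xs)              ≡⟨ ∑-distrib-+ (λ i → 𝟙 (Ls i) x) _ ⟩
        sum (λ i → 𝟙 (Ls i) x) + sum (λ i → count (Ls i) xs)  ≤⟨ ℕ.+-mono-≤ (sieve-pointwise x) (sieve xs) ⟩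
        (𝟙 L x + k * 𝟙 L₀ x) + (count L xs + k * count L₀ xs) ≡⟨ rearrange (𝟙 L x) (𝟙 L₀ x) (count L xs) (count L₀ xs) k ⟩
        (𝟙 L x + count L xs) + k * (𝟙 L₀ x + count L₀ xs)     ≡⟨ cong₂ (λ a b → a + k * b) (count-∷ L x xs) (count-∷ L₀ x xs) ⟨
        count L (x ∷ xs) + k * count L₀ (x ∷ xs)              ∎
        where
        open ℕ.≤-Reasoning
        open import Data.Nat.Solver using (module +-*-Solver)
        open +-*-Solver
        k = r ∸ 1
        rearrange : ∀ a b c d k → (a + k * b) + (c + k * d) ≡ (a + c) + k * (b + d)
        rearrange = solve 5 (λ a b c d k → (a :+ k :* b) :+ (c :+ k :* d) := (a :+ c) :+ k :* (b :+ d)) refl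

      sieve-length : ∀ {U} → Unique U → (∀ x → x ∈ U) → Unique L → Unique L₀ → (∀ i → Unique (Ls i)) →
                     sum (length ∘ Ls) ≤ length L + (r ∸ 1) * length L₀
      sieve-length {U} uU complete uL uL₀ uLs = subst₂ _≤_
        (sum-cong-≗ (λ i → count-complete (uLs i) uU complete))
        (cong₂ (λ a b → a + (r ∸ 1) * b) (count-complete uL uU complete) (count-complete uL₀ uU complete))
        (sieve U)

m<i⇒d<i∸[m∸d] : ∀ {d m i} → d ≤ m → m < i → d < i ∸ (m ∸ d)
m<i⇒d<i∸[m∸d] {d} {m} {i} d≤m m<i = ℕ.+-cancelʳ-< (m ∸ d) d (i ∸ (m ∸ d)) (begin-strict
  d ℕ.+ (m ∸ d)                ≡⟨ ℕ.+-comm d (m ∸ d) ⟩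
  (m ∸ d) ℕ.+ d                ≡⟨ ℕ.m∸n+n≡m d≤m ⟩
  m                            <⟨ m<i ⟩
  i                            ≡⟨ ℕ.m∸n+n≡m (ℕ.≤-trans (ℕ.m∸n≤m m d) (ℕ.<⇒≤ m<i)) ⟨
  (i ∸ (m ∸ d)) ℕ.+ (m ∸ d)    ∎)
  where open ℕ.≤-Reasoning

prime-divisor : ∀ {d} → 2 ≤ d → ∃[ p ] Prime p × p ∣ d
prime-divisor {d@(suc _)} 2≤d with factorise d
... | record { factors = [] ; isFactorisation = d≡1 } = ⊥-elim (ℕ.<⇒≢ 2≤d (sym d≡1))
... | record { factors = p ∷ ps ; isFactorisation = d≡p*ps ; factorsPrime = p-prime ∷ _ } =
  p , p-prime , divides (ℕ.product ps) (trans d≡p*ps (ℕ.*-comm p _))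

prime∣lcmᶠ : ∀ {r} (ms : Fin r → ℕ) {p} → Prime p → p ∣ lcmᶠ ms → ∃[ i ] p ∣ ms i
prime∣lcmᶠ {zero}  ms p-prime p∣1 = ⊥-elim (¬prime[1] (subst Prime (∣1⇒≡1 p∣1) p-prime))
prime∣lcmᶠ {suc r} ms p-prime p∣lcm
  with euclidsLemma (ms Fin.zero) (lcmᶠ (ms ∘ Fin.suc)) p-prime
         (∣-trans p∣lcm (divides (gcd (ms Fin.zero) (lcmᶠ (ms ∘ Fin.suc))) (sym (gcd*lcm (ms Fin.zero) (lcmᶠ (ms ∘ Fin.suc))))))
... | inj₁ p∣m₀ = Fin.zero , p∣m₀
... | inj₂ p∣lcm′ with prime∣lcmᶠ (ms ∘ Fin.suc) p-prime p∣lcm′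
...   | i , p∣mᵢ = Fin.suc i , p∣mᵢ

divisor-positive : ∀ {m n} → m ∣ n → 0 < n → 0 < m
divisor-positive {zero}  0∣n 0<n = ⊥-elim (ℕ.<⇒≢ 0<n (sym (0∣⇒≡0 0∣n)))
divisor-positive {suc m} _   _   = s≤s z≤n

m≤n+o⇒+m-+o≤+n : ∀ {m n o} → m ≤ n ℕ.+ o → ℤ.+ m ℤ.- ℤ.+ o ℤ.≤ ℤ.+ n
m≤n+o⇒+m-+o≤+n {m} {n} {o} m≤n+o = begin
  ℤ.+ m ℤ.- ℤ.+ o              ≤⟨ ℤ.+-monoˡ-≤ (ℤ.- ℤ.+ o) (ℤ.+≤+ m≤n+o) ⟩
  ℤ.+ (n ℕ.+ o) ℤ.- ℤ.+ o      ≡⟨ ℤ.[+m]-[+n]≡m⊖n (n ℕ.+ o) o ⟩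
  (n ℕ.+ o) ℤ.⊖ o              ≡⟨ ℤ.⊖-≥ (ℕ.m≤n+m o n) ⟩
  ℤ.+ (n ℕ.+ o ∸ o)            ≡⟨ cong ℤ.+_ (ℕ.m+n∸n≡m n o) ⟩
  ℤ.+ n                        ∎
  where open ℤ.≤-Reasoning

-- Binomial coefficients modulo a prime

prime∤! : ∀ {p} → Prime p → ∀ {k} → k < p → p ∤ k !
prime∤! p-prime {zero}  _   p∣1 = ¬prime[1] (subst Prime (∣1⇒≡1 p∣1) p-prime)
prime∤! p-prime {suc k} k<p p∣k! with euclidsLemma (suc k) (k !) p-prime p∣k!
... | inj₁ p∣1+k = ℕ.<⇒≱ k<p (∣⇒≤ p∣1+k)
... | inj₂ p∣k!  = prime∤! p-prime (ℕ.<-trans (ℕ.n<1+n k) k<p) p∣k!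

-- p divides p! = (p C k) · k! · (p ∸ k)!, but divides neither factorial.
prime∣pCk : ∀ {p k} → Prime p → 0 < k → k < p → p ∣ p C k
prime∣pCk {suc p′} {k} p-prime 0<k k<p
  with euclidsLemma (p C k) (k ! ℕ.* (p ∸ k) !) p-prime (subst (p ∣_) (sym pCk*k!*[p∸k]!≡p!) (m∣m*n (p′ !)))
  where
  p = suc p′
  instance _ = k ℕ.!* (p ∸ k) !≢0
  pCk*k!*[p∸k]!≡p! : (p C k) ℕ.* (k ! ℕ.* (p ∸ k) !) ≡ p !
  pCk*k!*[p∸k]!≡p! = trans (cong (λ c → c ℕ.* (k ! ℕ.* (p ∸ k) !)) (nCk≡n!/k![n-k]! (ℕ.<⇒≤ k<p))) (m/n*n≡m (k![n∸k]!∣n! (ℕ.<⇒≤ k<p)))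
... | inj₁ p∣pCk = p∣pCk
... | inj₂ p∣k!*[p∸k]! with euclidsLemma (k !) ((suc p′ ∸ k) !) p-prime p∣k!*[p∸k]!
...   | inj₁ p∣k!     = ⊥-elim (prime∤! p-prime k<p p∣k!)
...   | inj₂ p∣[p∸k]! = ⊥-elim (prime∤! p-prime (ℕ.∸-monoʳ-< 0<k (ℕ.<⇒≤ k<p)) p∣[p∸k]!)

-- Finite fields

module FieldProperties (K : FiniteField) where
  open FiniteField K hiding (card)

  commutativeRing : CommutativeRing 0ℓ 0ℓ
  commutativeRing = record
    { Carrier = Carrier ; _≈_ = _≡_ ; _+_ = _+_ ; _*_ = _*_ ; -_ = -_ ; 0# = 0# ; 1# = 1#
    ; isCommutativeRing = isCommutativeRing }

  open CommutativeRing commutativeRing public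
    using ( +-assoc; +-comm; +-identityˡ; +-identityʳ; -‿inverseˡ; -‿inverseʳ
          ; *-assoc; *-comm; *-identityˡ; *-identityʳ; distribˡ; distribʳ; zeroˡ; zeroʳ
          ; +-isCommutativeMonoid; *-isCommutativeMonoid; +-commutativeSemigroup
          ; semiring; commutativeSemiring; ring )
  open import Algebra.Definitions.RawSemiring (Semiring.rawSemiring semiring) public
    using () renaming (_×_ to _·_; _^_ to _^ᴿ_)
  open import Algebra.Properties.Semiring.Exp semiring using (^-assocʳ)
  open import Algebra.Properties.CommutativeSemiring.Exp commutativeSemiring using (^-distrib-*)
  open import Algebra.Properties.Semiring.Mult semiring using (×1-homo-*)
  open import Algebra.Properties.Ring ring public using (+-cancelˡ; +-cancelʳ; -1*x≈-x)
  open import Algebra.Properties.CommutativeSemigroup +-commutativeSemigroup public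
    using () renaming (interchange to +-interchange)
  open import Algebra.Properties.CommutativeSemigroup (CommutativeRing.*-commutativeSemigroup commutativeRing)
    using () renaming (interchange to *-interchange)
  open ≡-Reasoning

  infix 4 _≟_
  _≟_ : DecidableEquality Carrier
  _≟_ = enumeration⇒decEq elements-complete

  -- The power of Defs and the library's semiring power unfold alike, so the library's laws transfer.
  ^≡^ᴿ : ∀ x n → x ^ n ≡ x ^ᴿ n
  ^≡^ᴿ x zero    = refl
  ^≡^ᴿ x (suc n) = cong (x *_) (^≡^ᴿ x n)

  ^-*-assoc : ∀ x m n → (x ^ m) ^ n ≡ x ^ (m ℕ.* n)
  ^-*-assoc x m n rewrite ^≡^ᴿ x (m ℕ.* n) | ^≡^ᴿ (x ^ m) n | ^≡^ᴿ x m = ^-assocʳ x m n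

  ^-distribʳ-* : ∀ x y n → (x * y) ^ n ≡ x ^ n * y ^ n
  ^-distribʳ-* x y n rewrite ^≡^ᴿ (x * y) n | ^≡^ᴿ x n | ^≡^ᴿ y n = ^-distrib-* x y n

  0^suc : ∀ n → 0# ^ suc n ≡ 0#
  0^suc n = zeroˡ _

  inverseˡ : ∀ {x} → x ≢ 0# → x ⁻¹ * x ≡ 1#
  inverseˡ {x} x≢0 = trans (*-comm _ x) (inverseʳ x x≢0)

  *-cancelˡ : ∀ {x y z} → x ≢ 0# → x * y ≡ x * z → y ≡ z
  *-cancelˡ {x} {y} {z} x≢0 xy≡xz = begin
    y               ≡⟨ *-identityˡ y ⟨
    1# * y          ≡⟨ cong (_* y) (inverseˡ x≢0) ⟨
    x ⁻¹ * x * y    ≡⟨ *-assoc _ x y ⟩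
    x ⁻¹ * (x * y)  ≡⟨ cong (x ⁻¹ *_) xy≡xz ⟩
    x ⁻¹ * (x * z)  ≡⟨ *-assoc _ x z ⟨
    x ⁻¹ * x * z    ≡⟨ cong (_* z) (inverseˡ x≢0) ⟩
    1# * z          ≡⟨ *-identityˡ z ⟩
    z               ∎

  *-nonzero : ∀ {x y} → x ≢ 0# → y ≢ 0# → x * y ≢ 0#
  *-nonzero x≢0 y≢0 xy≡0 = y≢0 (*-cancelˡ x≢0 (trans xy≡0 (sym (zeroʳ _))))

  ^-nonzero : ∀ {x} n → x ≢ 0# → x ^ n ≢ 0#
  ^-nonzero zero    _   = 0≢1 ∘ sym
  ^-nonzero (suc n) x≢0 = *-nonzero x≢0 (^-nonzero n x≢0)

  x^n≡0⇒x≡0 : ∀ {x} n → x ^ n ≡ 0# → x ≡ 0#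
  x^n≡0⇒x≡0 {x} n xⁿ≡0 = decidable-stable (x ≟ 0#) (λ x≢0 → ^-nonzero n x≢0 xⁿ≡0)

  ·1-homo-^ : ∀ m e → (m ℕ.^ e) · 1# ≡ (m · 1#) ^ e
  ·1-homo-^ m zero    = +-identityʳ 1#
  ·1-homo-^ m (suc e) = trans (×1-homo-* m (m ℕ.^ e)) (cong ((m · 1#) *_) (·1-homo-^ m e))

  units : List Carrier
  units = filter (λ x → ¬? (x ≟ 0#)) elements

  ∈-units⁺ : ∀ {x} → x ≢ 0# → x ∈ units
  ∈-units⁺ x≢0 = ∈-filter⁺ (λ x → ¬? (x ≟ 0#)) (elements-complete _) x≢0

  ∈-units⁻ : ∀ {x} → x ∈ units → x ≢ 0#
  ∈-units⁻ = proj₂ ∘ ∈-filter⁻ (λ x → ¬? (x ≟ 0#)) {xs = elements}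

  units-unique : Unique units
  units-unique = Unique.filter⁺ (λ x → ¬? (x ≟ 0#)) elements-unique

  elements↭0∷units : elements ↭ 0# ∷ units
  elements↭0∷units = ↭-from-members elements-unique
    (All.tabulate (λ x∈units → ∈-units⁻ x∈units ∘ sym) ∷ units-unique)
    (mk⇔ (λ _ → zero-or-unit _) (λ _ → elements-complete _))
    where
    zero-or-unit : ∀ x → x ∈ 0# ∷ units
    zero-or-unit x with x ≟ 0#
    ... | yes x≡0 = here x≡0
    ... | no  x≢0 = there (∈-units⁺ x≢0)

  card≡1+|units| : card K ≡ suc (length units)
  card≡1+|units| = ↭-length elements↭0∷units

  map-*↭units : ∀ {a} → a ≢ 0# → map (a *_) units ↭ units
  map-*↭units {a} a≢0 = ↭-from-members (Unique.map⁺ (*-cancelˡ a≢0) units-unique) units-unique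
    (mk⇔ to from)
    where
    to : ∀ {y} → y ∈ map (a *_) units → y ∈ units
    to y∈ with ∈-map⁻ (a *_) y∈
    ... | x , x∈units , refl = ∈-units⁺ (*-nonzero a≢0 (∈-units⁻ x∈units))
    from : ∀ {y} → y ∈ units → y ∈ map (a *_) units
    from {y} y∈units = subst (_∈ map (a *_) units) a[a⁻¹y]≡y
      (∈-map⁺ (a *_) (∈-units⁺ (*-nonzero (λ a⁻¹≡0 → 0≢1 (a⁻¹≡0⇒0≡1 a⁻¹≡0)) (∈-units⁻ y∈units))))
      where
      a⁻¹≡0⇒0≡1 : a ⁻¹ ≡ 0# → 0# ≡ 1#
      a⁻¹≡0⇒0≡1 a⁻¹≡0 = trans (sym (zeroʳ a)) (trans (cong (a *_) (sym a⁻¹≡0)) (inverseʳ a a≢0))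
      a[a⁻¹y]≡y : a * (a ⁻¹ * y) ≡ y
      a[a⁻¹y]≡y = trans (sym (*-assoc a _ y)) (trans (cong (_* y) (inverseʳ a a≢0)) (*-identityˡ y))

  product : List Carrier → Carrier
  product = foldr _*_ 1#

  product-map-* : ∀ a xs → product (map (a *_) xs) ≡ a ^ length xs * product xs
  product-map-* a []       = sym (*-identityˡ 1#)
  product-map-* a (x ∷ xs) = begin
    a * x * product (map (a *_) xs)  ≡⟨ cong (a * x *_) (product-map-* a xs) ⟩
    a * x * (a ^ n * product xs)     ≡⟨ *-interchange a x (a ^ n) (product xs) ⟩
    a * a ^ n * (x * product xs)     ∎
    where n = length xs

  product-nonzero : ∀ {xs} → (∀ {x} → x ∈ xs → x ≢ 0#) → product xs ≢ 0#
  product-nonzero {[]}     _       = 0≢1 ∘ sym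
  product-nonzero {x ∷ xs} nonzero = *-nonzero (nonzero (here refl)) (product-nonzero (nonzero ∘ there))

  -- x ↦ a·x permutes the units, so aⁿ·∏ units = ∏ units with n = card K ∸ 1.
  fermat : ∀ a → a ^ card K ≡ a
  fermat a rewrite card≡1+|units| with a ≟ 0#
  ... | yes refl = 0^suc (length units)
  ... | no  a≢0  = trans (cong (a *_) aⁿ≡1) (*-identityʳ a)
    where
    n = length units
    P = product units
    aⁿ≡1 : a ^ n ≡ 1#
    aⁿ≡1 = *-cancelˡ (product-nonzero ∈-units⁻) (begin
      P * a ^ n                  ≡⟨ *-comm P _ ⟩
      a ^ n * P                  ≡⟨ product-map-* a units ⟨
      product (map (a *_) units) ≡⟨ foldr-↭ *-isCommutativeMonoid (map-*↭units a≢0) ⟩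
      P                          ≡⟨ *-identityʳ P ⟨
      P * 1#                     ∎)

  sum : List Carrier → Carrier
  sum = foldr _+_ 0#

  sum-map-+1 : ∀ xs → sum (map (_+ 1#) xs) ≡ sum xs + length xs · 1#
  sum-map-+1 []       = sym (+-identityʳ 0#)
  sum-map-+1 (x ∷ xs) = trans (cong (x + 1# +_) (sum-map-+1 xs)) (+-interchange x 1# (sum xs) _)

  map-+1↭elements : map (_+ 1#) elements ↭ elements
  map-+1↭elements = ↭-from-members (Unique.map⁺ (+-cancelʳ 1# _ _) elements-unique) elements-unique
    (mk⇔ (λ _ → elements-complete _) (λ _ → subst (_∈ map (_+ 1#) elements) (y-1+1≡y _) (∈-map⁺ (_+ 1#) (elements-complete _))))
    where
    y-1+1≡y : ∀ y → y + - 1# + 1# ≡ y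
    y-1+1≡y y = trans (+-assoc y _ _) (trans (cong (y +_) (-‿inverseˡ 1#)) (+-identityʳ y))

  -- x ↦ x + 1 permutes K, so Σ K = Σ K + (card K)·1.
  card·1≡0 : card K · 1# ≡ 0#
  card·1≡0 = +-cancelˡ (sum elements) _ _ (begin
    sum elements + card K · 1#     ≡⟨ sum-map-+1 elements ⟨
    sum (map (_+ 1#) elements)     ≡⟨ foldr-↭ +-isCommutativeMonoid map-+1↭elements ⟩
    sum elements                   ≡⟨ +-identityʳ _ ⟨
    sum elements + 0#              ∎)

  prime-power-card⇒char : ∀ {p e} → card K ≡ p ℕ.^ e → p · 1# ≡ 0#
  prime-power-card⇒char {p} {e} card≡pᵉ = x^n≡0⇒x≡0 e (begin
    (p · 1#) ^ e       ≡⟨ ·1-homo-^ p e ⟨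
    (p ℕ.^ e) · 1#     ≡⟨ cong (_· 1#) card≡pᵉ ⟨
    card K · 1#        ≡⟨ card·1≡0 ⟩
    0#                 ∎)

module Frobenius (K : FiniteField) where
  open FiniteField K hiding (card)
  open FieldProperties K hiding (sum)
  open import Algebra.Properties.CommutativeSemiring.Binomial commutativeSemiring using (theorem; binomialTerm)
  open import Algebra.Properties.Semiring.Sum semiring using (sum; sum-init-last; sum-cong-≗; sum-replicate-zero)
  open import Algebra.Properties.Semiring.Mult semiring using (×-assoc-*; ×1-homo-*)
  open ≡-Reasoning

  pCk·z≡0 : ∀ {p} → Prime p → p · 1# ≡ 0# → ∀ {k} → 0 < k → k < p → ∀ z → (p C k) · z ≡ 0#
  pCk·z≡0 {p} p-prime char {k} 0<k k<p z with prime∣pCk p-prime 0<k k<p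
  ... | divides c pCk≡c*p = begin
    (p C k) · z                 ≡⟨ cong (_· z) pCk≡c*p ⟩
    (c ℕ.* p) · z               ≡⟨ cong ((c ℕ.* p) ·_) (*-identityˡ z) ⟨
    (c ℕ.* p) · (1# * z)        ≡⟨ ×-assoc-* (c ℕ.* p) 1# z ⟨
    (c ℕ.* p) · 1# * z          ≡⟨ cong (_* z) (×1-homo-* c p) ⟩
    c · 1# * (p · 1#) * z       ≡⟨ cong (λ u → c · 1# * u * z) char ⟩
    c · 1# * 0# * z             ≡⟨ cong (_* z) (zeroʳ _) ⟩
    0# * z                      ≡⟨ zeroˡ z ⟩
    0#                          ∎

  binomial-extremes : ∀ n → (∀ {k} → 0 < k → k < suc n → ∀ z → (suc n C k) · z ≡ 0#) →
                      ∀ x y → (x + y) ^ suc n ≡ x ^ suc n + y ^ suc n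
  binomial-extremes n inner-vanish x y = begin
    (x + y) ^ suc n                                      ≡⟨ ^≡^ᴿ (x + y) (suc n) ⟩
    (x + y) ^ᴿ suc n                                     ≡⟨ theorem (suc n) x y ⟩
    t Fin.zero + sum (t ∘ Fin.suc)                       ≡⟨ cong (t Fin.zero +_) (sum-init-last (t ∘ Fin.suc)) ⟩
    t Fin.zero + (sum inner + t (Fin.suc (Fin.fromℕ n))) ≡⟨ cong₂ (λ a b → t Fin.zero + (a + b)) inner≡0 last≡xⁿ⁺¹ ⟩
    t Fin.zero + (0# + x ^ᴿ suc n)                       ≡⟨ cong₂ _+_ first≡yⁿ⁺¹ (+-identityˡ _) ⟩
    y ^ᴿ suc n + x ^ᴿ suc n                              ≡⟨ +-comm _ _ ⟩
    x ^ᴿ suc n + y ^ᴿ suc n                              ≡⟨ cong₂ _+_ (^≡^ᴿ x (suc n)) (^≡^ᴿ y (suc n)) ⟨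
    x ^ suc n + y ^ suc n                                ∎
    where
    t = binomialTerm x y (suc n)
    inner = Vector.init (t ∘ Fin.suc)
    first≡yⁿ⁺¹ : t Fin.zero ≡ y ^ᴿ suc n
    first≡yⁿ⁺¹ = trans (+-identityʳ _) (*-identityˡ _)
    last≡xⁿ⁺¹ : t (Fin.suc (Fin.fromℕ n)) ≡ x ^ᴿ suc n
    last≡xⁿ⁺¹ rewrite Fin.toℕ-fromℕ n | nCn≡1 (suc n) | ℕ.n∸n≡0 n = trans (+-identityʳ _) (*-identityʳ _)
    inner≡0 : sum inner ≡ 0#
    inner≡0 = trans (sum-cong-≗ (λ i → inner-vanish (s≤s z≤n) (s≤s (subst (_< n) (sym (Fin.toℕ-inject₁ i)) (Fin.toℕ<n i))) _))
                    (sum-replicate-zero n)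

  frobenius : ∀ {p} → Prime p → p · 1# ≡ 0# → ∀ x y → (x + y) ^ p ≡ x ^ p + y ^ p
  frobenius {zero}  p-prime char = ⊥-elim (¬prime[0] p-prime)
  frobenius {suc n} p-prime char = binomial-extremes n (pCk·z≡0 p-prime char)

  frobenius-^ : ∀ {p} → Prime p → p · 1# ≡ 0# → ∀ j x y → (x + y) ^ (p ℕ.^ j) ≡ x ^ (p ℕ.^ j) + y ^ (p ℕ.^ j)
  frobenius-^ p-prime char zero    x y = trans (*-identityʳ _) (cong₂ _+_ (sym (*-identityʳ x)) (sym (*-identityʳ y)))
  frobenius-^ {p} p-prime char (suc j) x y = begin
    (x + y) ^ (p ℕ.* p ℕ.^ j)                    ≡⟨ ^-*-assoc (x + y) p _ ⟨
    ((x + y) ^ p) ^ (p ℕ.^ j)                    ≡⟨ cong (_^ (p ℕ.^ j)) (frobenius p-prime char x y) ⟩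
    (x ^ p + y ^ p) ^ (p ℕ.^ j)                  ≡⟨ frobenius-^ p-prime char j (x ^ p) (y ^ p) ⟩
    (x ^ p) ^ (p ℕ.^ j) + (y ^ p) ^ (p ℕ.^ j)    ≡⟨ cong₂ _+_ (^-*-assoc x p _) (^-*-assoc y p _) ⟩
    x ^ (p ℕ.* p ℕ.^ j) + y ^ (p ℕ.* p ℕ.^ j)    ∎

-- Polynomials over a finite field

module PolynomialArithmetic (F : FiniteField) where
  open FiniteField F hiding (card)
  open FieldProperties F
  open Poly F public

  coef : Coeffs → ℕ → Carrier
  coef []      _       = 0#
  coef (a ∷ p) zero    = a
  coef (a ∷ p) (suc i) = coef p i

  -- Coefficient lists that differ only by trailing zeros are the same polynomial.
  infix 4 _≈_
  record _≈_ (p q : Coeffs) : Set where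
    constructor mk≈
    field at : ∀ i → coef p i ≡ coef q i
  open _≈_ public

  ≈-isEquivalence : IsEquivalence _≈_
  ≈-isEquivalence = record
    { refl  = mk≈ λ _ → refl
    ; sym   = λ p≈q → mk≈ λ i → sym (at p≈q i)
    ; trans = λ p≈q q≈r → mk≈ λ i → trans (at p≈q i) (at q≈r i) }

  ≈-setoid : Setoid 0ℓ 0ℓ
  ≈-setoid = record { isEquivalence = ≈-isEquivalence }

  open IsEquivalence ≈-isEquivalence public using () renaming (refl to ≈-refl; sym to ≈-sym; trans to ≈-trans)
  module ≈-Reasoning = SetoidReasoning ≈-setoid

  ∷-cong : ∀ {a b p q} → a ≡ b → p ≈ q → a ∷ p ≈ b ∷ q
  ∷-cong a≡b p≈q = mk≈ λ { zero → a≡b ; (suc i) → at p≈q i }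

  ∷-tail : ∀ {a b p q} → a ∷ p ≈ b ∷ q → p ≈ q
  ∷-tail a∷p≈b∷q = mk≈ (at a∷p≈b∷q ∘ suc)

  0∷-cong : ∀ {p} → p ≈ [] → 0# ∷ p ≈ []
  0∷-cong p≈[] = mk≈ λ { zero → refl ; (suc i) → at p≈[] i }

  ≈[]-head : ∀ {a p} → a ∷ p ≈ [] → a ≡ 0#
  ≈[]-head a∷p≈[] = at a∷p≈[] zero

  ≈[]-tail : ∀ {a p} → a ∷ p ≈ [] → p ≈ []
  ≈[]-tail a∷p≈[] = mk≈ (at a∷p≈[] ∘ suc)

  coef-padd : ∀ p q i → coef (padd p q) i ≡ coef p i + coef q i
  coef-padd []      q       i       = sym (+-identityˡ _)
  coef-padd (a ∷ p) []      i       = sym (+-identityʳ _)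
  coef-padd (a ∷ p) (b ∷ q) zero    = refl
  coef-padd (a ∷ p) (b ∷ q) (suc i) = coef-padd p q i

  padd-isCommutativeMonoid : IsCommutativeMonoid _≈_ padd []
  padd-isCommutativeMonoid = record
    { isMonoid = record
      { isSemigroup = record
        { isMagma = record
          { isEquivalence = ≈-isEquivalence
          ; ∙-cong = λ {p} {p′} {q} {q′} p≈p′ q≈q′ → mk≈ λ i → begin
              coef (padd p q) i      ≡⟨ coef-padd p q i ⟩
              coef p i + coef q i    ≡⟨ cong₂ _+_ (at p≈p′ i) (at q≈q′ i) ⟩
              coef p′ i + coef q′ i  ≡⟨ coef-padd p′ q′ i ⟨
              coef (padd p′ q′) i    ∎ }
        ; assoc = λ p q r → mk≈ λ i → begin
            coef (padd (padd p q) r) i          ≡⟨ coef-padd (padd p q) r i ⟩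
            coef (padd p q) i + coef r i        ≡⟨ cong (_+ coef r i) (coef-padd p q i) ⟩
            coef p i + coef q i + coef r i      ≡⟨ +-assoc _ _ _ ⟩
            coef p i + (coef q i + coef r i)    ≡⟨ cong (coef p i +_) (coef-padd q r i) ⟨
            coef p i + coef (padd q r) i        ≡⟨ coef-padd p (padd q r) i ⟨
            coef (padd p (padd q r)) i          ∎ }
      ; identity = (λ _ → ≈-refl) , (λ p → mk≈ λ i → trans (coef-padd p [] i) (+-identityʳ _)) }
    ; comm = λ p q → mk≈ λ i → trans (coef-padd p q i) (trans (+-comm _ _) (sym (coef-padd q p i))) }
    where open ≡-Reasoning

  padd-commutativeMonoid : CommutativeMonoid 0ℓ 0ℓ
  padd-commutativeMonoid = record { isCommutativeMonoid = padd-isCommutativeMonoid }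

  open CommutativeMonoid padd-commutativeMonoid public using ()
    renaming (∙-cong to padd-cong; assoc to padd-assoc; comm to padd-comm; identityʳ to padd-identityʳ)
  open import Algebra.Properties.CommutativeSemigroup (CommutativeMonoid.commutativeSemigroup padd-commutativeMonoid) public
    using () renaming (interchange to padd-interchange; x∙yz≈y∙xz to padd-x∙yz≈y∙xz; xy∙z≈xz∙y to padd-xy∙z≈xz∙y)

  padd-congˡ : ∀ p {q q′} → q ≈ q′ → padd p q ≈ padd p q′
  padd-congˡ p = padd-cong (≈-refl {p})

  padd-congʳ : ∀ {p p′} q → p ≈ p′ → padd p q ≈ padd p′ q
  padd-congʳ q p≈p′ = padd-cong p≈p′ (≈-refl {q})

  scale : Carrier → Coeffs → Coeffs
  scale c = map (c *_)

  coef-scale : ∀ c p i → coef (scale c p) i ≡ c * coef p i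
  coef-scale c []      i       = sym (zeroʳ c)
  coef-scale c (a ∷ p) zero    = refl
  coef-scale c (a ∷ p) (suc i) = coef-scale c p i

  scale-cong : ∀ c {p q} → p ≈ q → scale c p ≈ scale c q
  scale-cong c {p} {q} p≈q = mk≈ λ i → trans (coef-scale c p i) (trans (cong (c *_) (at p≈q i)) (sym (coef-scale c q i)))

  scale-zero : ∀ p → scale 0# p ≈ []
  scale-zero p = mk≈ λ i → trans (coef-scale 0# p i) (zeroˡ _)

  scale-one : ∀ p → scale 1# p ≈ p
  scale-one p = mk≈ λ i → trans (coef-scale 1# p i) (*-identityˡ _)

  scale-assoc : ∀ c d p → scale c (scale d p) ≈ scale (c * d) p
  scale-assoc c d p = mk≈ λ i →
    trans (coef-scale c (scale d p) i) (trans (cong (c *_) (coef-scale d p i)) (trans (sym (*-assoc c d _)) (sym (coef-scale _ p i))))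

  scale-distrib-padd : ∀ c p q → scale c (padd p q) ≈ padd (scale c p) (scale c q)
  scale-distrib-padd c p q = mk≈ λ i → begin
    coef (scale c (padd p q)) i                   ≡⟨ coef-scale c (padd p q) i ⟩
    c * coef (padd p q) i                         ≡⟨ cong (c *_) (coef-padd p q i) ⟩
    c * (coef p i + coef q i)                     ≡⟨ distribˡ c _ _ ⟩
    c * coef p i + c * coef q i                   ≡⟨ cong₂ _+_ (coef-scale c p i) (coef-scale c q i) ⟨
    coef (scale c p) i + coef (scale c q) i       ≡⟨ coef-padd (scale c p) _ i ⟨
    coef (padd (scale c p) (scale c q)) i         ∎
    where open ≡-Reasoning

  scale-distrib-+ : ∀ a b p → scale (a + b) p ≈ padd (scale a p) (scale b p)
  scale-distrib-+ a b p = mk≈ λ i → begin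
    coef (scale (a + b) p) i                      ≡⟨ coef-scale (a + b) p i ⟩
    (a + b) * coef p i                            ≡⟨ distribʳ _ a b ⟩
    a * coef p i + b * coef p i                   ≡⟨ cong₂ _+_ (coef-scale a p i) (coef-scale b p i) ⟨
    coef (scale a p) i + coef (scale b p) i       ≡⟨ coef-padd (scale a p) _ i ⟨
    coef (padd (scale a p) (scale b p)) i         ∎
    where open ≡-Reasoning

  0∷-padd : ∀ p q → 0# ∷ padd p q ≈ padd (0# ∷ p) (0# ∷ q)
  0∷-padd p q = ∷-cong (sym (+-identityʳ 0#)) ≈-refl

  pmul-zeroˡ : ∀ {p} q → p ≈ [] → pmul p q ≈ []
  pmul-zeroˡ {[]}    q _    = ≈-refl
  pmul-zeroˡ {a ∷ p} q p≈[] = begin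
    padd (scale a q) (0# ∷ pmul p q)  ≈⟨ padd-cong (scale-zero′ (≈[]-head p≈[])) (0∷-cong (pmul-zeroˡ q (≈[]-tail p≈[]))) ⟩
    padd [] []                        ≈⟨ ≈-refl ⟩
    []                                ∎
    where
    open ≈-Reasoning
    scale-zero′ : a ≡ 0# → scale a q ≈ []
    scale-zero′ refl = scale-zero q

  pmul-zeroʳ : ∀ p → pmul p [] ≈ []
  pmul-zeroʳ []      = ≈-refl
  pmul-zeroʳ (a ∷ p) = 0∷-cong (pmul-zeroʳ p)

  pmul-congʳ : ∀ p {q q′} → q ≈ q′ → pmul p q ≈ pmul p q′
  pmul-congʳ []      q≈q′ = ≈-refl
  pmul-congʳ (a ∷ p) q≈q′ = padd-cong (scale-cong a q≈q′) (∷-cong refl (pmul-congʳ p q≈q′))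

  pmul-congˡ : ∀ {p p′} q → p ≈ p′ → pmul p q ≈ pmul p′ q
  pmul-congˡ {[]}    q p≈p′ = ≈-sym (pmul-zeroˡ q (≈-sym p≈p′))
  pmul-congˡ {a ∷ p} {[]} q p≈p′ = pmul-zeroˡ q p≈p′
  pmul-congˡ {a ∷ p} {a′ ∷ p′} q p≈p′ with at p≈p′ zero
  ... | refl = padd-congˡ (scale a q) (∷-cong refl (pmul-congˡ q (∷-tail p≈p′)))

  pmul-distribʳ : ∀ p p′ q → pmul (padd p p′) q ≈ padd (pmul p q) (pmul p′ q)
  pmul-distribʳ []      p′       q = ≈-refl
  pmul-distribʳ (a ∷ p) []       q = ≈-sym (padd-identityʳ _)
  pmul-distribʳ (a ∷ p) (a′ ∷ p′) q = begin
    padd (scale (a + a′) q) (0# ∷ pmul (padd p p′) q)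
      ≈⟨ padd-cong (scale-distrib-+ a a′ q) (∷-cong refl (pmul-distribʳ p p′ q)) ⟩
    padd (padd (scale a q) (scale a′ q)) (0# ∷ padd (pmul p q) (pmul p′ q))
      ≈⟨ padd-congˡ (padd (scale a q) (scale a′ q)) (0∷-padd (pmul p q) (pmul p′ q)) ⟩
    padd (padd (scale a q) (scale a′ q)) (padd (0# ∷ pmul p q) (0# ∷ pmul p′ q))
      ≈⟨ padd-interchange (scale a q) (scale a′ q) (0# ∷ pmul p q) (0# ∷ pmul p′ q) ⟩
    padd (pmul (a ∷ p) q) (pmul (a′ ∷ p′) q)
      ∎
    where open ≈-Reasoning

  pmul-scaleˡ : ∀ c p q → pmul (scale c p) q ≈ scale c (pmul p q)
  pmul-scaleˡ c []      q = ≈-refl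
  pmul-scaleˡ c (a ∷ p) q = begin
    padd (scale (c * a) q) (0# ∷ pmul (scale c p) q)
      ≈⟨ padd-cong (≈-sym (scale-assoc c a q)) (∷-cong (sym (zeroʳ c)) (pmul-scaleˡ c p q)) ⟩
    padd (scale c (scale a q)) (scale c (0# ∷ pmul p q))
      ≈⟨ scale-distrib-padd c (scale a q) (0# ∷ pmul p q) ⟨
    scale c (pmul (a ∷ p) q)
      ∎
    where open ≈-Reasoning

  pmul-0∷ : ∀ p q → pmul (0# ∷ p) q ≈ 0# ∷ pmul p q
  pmul-0∷ p q = padd-cong (scale-zero q) ≈-refl

  pmul-assoc : ∀ p q s → pmul (pmul p q) s ≈ pmul p (pmul q s)
  pmul-assoc []      q s = ≈-refl
  pmul-assoc (a ∷ p) q s = begin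
    pmul (padd (scale a q) (0# ∷ pmul p q)) s
      ≈⟨ pmul-distribʳ (scale a q) (0# ∷ pmul p q) s ⟩
    padd (pmul (scale a q) s) (pmul (0# ∷ pmul p q) s)
      ≈⟨ padd-cong (pmul-scaleˡ a q s) (≈-trans (pmul-0∷ (pmul p q) s) (∷-cong refl (pmul-assoc p q s))) ⟩
    pmul (a ∷ p) (pmul q s)
      ∎
    where open ≈-Reasoning

  pmul-∷ʳ : ∀ p b q → pmul p (b ∷ q) ≈ padd (scale b p) (0# ∷ pmul p q)
  pmul-∷ʳ []      b q = ≈-sym (0∷-cong ≈-refl)
  pmul-∷ʳ (a ∷ p) b q = ∷-cong (cong (_+ 0#) (*-comm a b)) (begin
    padd (scale a q) (pmul p (b ∷ q))
      ≈⟨ padd-congˡ (scale a q) (pmul-∷ʳ p b q) ⟩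
    padd (scale a q) (padd (scale b p) (0# ∷ pmul p q))
      ≈⟨ padd-x∙yz≈y∙xz (scale a q) (scale b p) (0# ∷ pmul p q) ⟩
    padd (scale b p) (pmul (a ∷ p) q)
      ∎)
    where open ≈-Reasoning

  pmul-comm : ∀ p q → pmul p q ≈ pmul q p
  pmul-comm []      q = ≈-sym (pmul-zeroʳ q)
  pmul-comm (a ∷ p) q = ≈-trans (padd-congˡ (scale a q) (∷-cong refl (pmul-comm p q))) (≈-sym (pmul-∷ʳ q a p))

  pmul-distribˡ : ∀ p q q′ → pmul p (padd q q′) ≈ padd (pmul p q) (pmul p q′)
  pmul-distribˡ p q q′ = begin
    pmul p (padd q q′)                ≈⟨ pmul-comm p _ ⟩
    pmul (padd q q′) p                ≈⟨ pmul-distribʳ q q′ p ⟩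
    padd (pmul q p) (pmul q′ p)       ≈⟨ padd-cong (pmul-comm q p) (pmul-comm q′ p) ⟩
    padd (pmul p q) (pmul p q′)       ∎
    where open ≈-Reasoning

  pmul-[c]ˡ : ∀ c p → pmul (c ∷ []) p ≈ scale c p
  pmul-[c]ˡ c p = ≈-trans (padd-congˡ (scale c p) (0∷-cong ≈-refl)) (padd-identityʳ (scale c p))

  pmul-[c]ʳ : ∀ c p → pmul p (c ∷ []) ≈ scale c p
  pmul-[c]ʳ c p = ≈-trans (pmul-comm p _) (pmul-[c]ˡ c p)

  pmul-identityˡ : ∀ p → pmul (1# ∷ []) p ≈ p
  pmul-identityˡ p = ≈-trans (pmul-[c]ˡ 1# p) (scale-one p)

  pmul-identityʳ : ∀ p → pmul p (1# ∷ []) ≈ p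
  pmul-identityʳ p = ≈-trans (pmul-[c]ʳ 1# p) (scale-one p)

  pneg : Coeffs → Coeffs
  pneg = scale (- 1#)

  padd-pneg : ∀ p → padd p (pneg p) ≈ []
  padd-pneg p = mk≈ λ i → trans (coef-padd p _ i)
    (trans (cong (coef p i +_) (trans (coef-scale (- 1#) p i) (-1*x≈-x (coef p i)))) (-‿inverseʳ _))

module Polynomials (F : FiniteField) where
  open FiniteField F hiding (card)
  open FieldProperties F
  open PolynomialArithmetic F public

  length-toPoly : ∀ h → length (toPoly h) ≡ suc (length h)
  length-toPoly h = trans (List.length-++ h) (ℕ.+-comm (length h) 1)

  coef-toPoly-length : ∀ h → coef (toPoly h) (length h) ≡ 1#
  coef-toPoly-length []      = refl
  coef-toPoly-length (a ∷ h) = coef-toPoly-length h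

  coef-toPoly-> : ∀ h {i} → length h < i → coef (toPoly h) i ≡ 0#
  coef-toPoly-> []      {suc i} _         = refl
  coef-toPoly-> (a ∷ h) {suc i} (s≤s h<i) = coef-toPoly-> h h<i

  toPoly≉[] : ∀ h → ¬ toPoly h ≈ []
  toPoly≉[] h toPoly-h≈[] = 0≢1 (trans (sym (at toPoly-h≈[] (length h))) (coef-toPoly-length h))

  toPoly-injective : ∀ {a b} → toPoly a ≡ toPoly b → a ≡ b
  toPoly-injective = List.++-cancelʳ (1# ∷ []) _ _

  -- Compare the leading coefficients, at positions length a and length b.
  toPoly≈scale-toPoly : ∀ {a b c} → c ≢ 0# → toPoly a ≈ scale c (toPoly b) → length a ≡ length b × c ≡ 1#
  toPoly≈scale-toPoly {a} {b} {c} c≢0 a≈cb = compare (ℕ.<-cmp (length a) (length b))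
    where
    a≈cb-at : ∀ j → coef (toPoly a) j ≡ c * coef (toPoly b) j
    a≈cb-at j = trans (at a≈cb j) (coef-scale c (toPoly b) j)
    a[lb]≡c : coef (toPoly a) (length b) ≡ c
    a[lb]≡c = trans (a≈cb-at (length b)) (trans (cong (c *_) (coef-toPoly-length b)) (*-identityʳ c))
    compare : Tri (length a < length b) (length a ≡ length b) (length b < length a) → length a ≡ length b × c ≡ 1#
    compare (tri< a<b _ _) = ⊥-elim (c≢0 (trans (sym a[lb]≡c) (coef-toPoly-> a a<b)))
    compare (tri> _ _ b<a) = ⊥-elim (0≢1 (trans (sym (trans (a≈cb-at (length a)) (trans (cong (c *_) (coef-toPoly-> b b<a)) (zeroʳ c))))
                                                (coef-toPoly-length a)))
    compare (tri≈ _ a≡b _) = a≡b , trans (sym a[lb]≡c) (trans (cong (coef (toPoly a)) (sym a≡b)) (coef-toPoly-length a))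

  ≈∧length≡⇒≡ : ∀ {p q} → length p ≡ length q → p ≈ q → p ≡ q
  ≈∧length≡⇒≡ {[]}    {[]}    _   _   = refl
  ≈∧length≡⇒≡ {a ∷ p} {b ∷ q} len p≈q = cong₂ _∷_ (at p≈q zero) (≈∧length≡⇒≡ (ℕ.suc-injective len) (∷-tail p≈q))

  toPoly-≈-injective : ∀ {a b} → toPoly a ≈ toPoly b → a ≡ b
  toPoly-≈-injective {a} {b} a≈b = toPoly-injective (≈∧length≡⇒≡ (begin
    length (toPoly a)  ≡⟨ length-toPoly a ⟩
    suc (length a)     ≡⟨ cong suc (proj₁ (toPoly≈scale-toPoly (0≢1 ∘ sym) (≈-trans a≈b (≈-sym (scale-one (toPoly b)))))) ⟩
    suc (length b)     ≡⟨ length-toPoly b ⟨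
    length (toPoly b)  ∎) a≈b)
    where open ≡-Reasoning

  padd-++ : ∀ X Y Z → length X ≤ length Y → padd X (Y ++ Z) ≡ padd X Y ++ Z
  padd-++ []      Y       Z _         = refl
  padd-++ (x ∷ X) (y ∷ Y) Z (s≤s X≤Y) = cong (x + y ∷_) (padd-++ X Y Z X≤Y)

  length-padd : ∀ X Y → length X ≤ length Y → length (padd X Y) ≡ length Y
  length-padd []      Y       _         = refl
  length-padd (x ∷ X) (y ∷ Y) (s≤s X≤Y) = cong suc (length-padd X Y X≤Y)

  pmul-[1]ˡ : ∀ x xs → pmul (1# ∷ []) (x ∷ xs) ≡ x ∷ xs
  pmul-[1]ˡ x xs = cong₂ _∷_ (trans (+-identityʳ _) (*-identityˡ x)) (begin
    padd (map (1# *_) xs) []  ≡⟨ padd-identityʳ′ (map (1# *_) xs) ⟩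
    map (1# *_) xs            ≡⟨ List.map-cong *-identityˡ xs ⟩
    map id xs                 ≡⟨ List.map-id xs ⟩
    xs                        ∎)
    where
    open ≡-Reasoning
    padd-identityʳ′ : ∀ X → padd X [] ≡ X
    padd-identityʳ′ []      = refl
    padd-identityʳ′ (x ∷ X) = refl

  monic-pmul : ∀ a b → ∃[ c ] pmul (toPoly a) (toPoly b) ≡ toPoly c × length c ≡ length a ℕ.+ length b
  monic-pmul []       []       = [] , pmul-[1]ˡ 1# [] , refl
  monic-pmul []       (b₀ ∷ b) = b₀ ∷ b , pmul-[1]ˡ b₀ (toPoly b) , refl
  monic-pmul (a₀ ∷ a) b with monic-pmul a b
  ... | c , ab≡c , length-c = padd X (0# ∷ c) , ab≡padd , trans (length-padd X (0# ∷ c) X≤0c) (cong suc length-c)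
    where
    X = scale a₀ (toPoly b)
    X≤0c : length X ≤ length (0# ∷ c)
    X≤0c = begin
      length X                  ≡⟨ List.length-map (a₀ *_) (toPoly b) ⟩
      length (toPoly b)         ≡⟨ length-toPoly b ⟩
      suc (length b)            ≤⟨ s≤s (ℕ.m≤n+m (length b) (length a)) ⟩
      suc (length a ℕ.+ length b) ≡⟨ cong suc length-c ⟨
      length (0# ∷ c)           ∎
      where open ℕ.≤-Reasoning
    ab≡padd : padd X (0# ∷ pmul (toPoly a) (toPoly b)) ≡ toPoly (padd X (0# ∷ c))
    ab≡padd = trans (cong (λ Y → padd X (0# ∷ Y)) ab≡c) (padd-++ X (0# ∷ c) (1# ∷ []) X≤0c)

  normalise : ∀ p → p ≈ [] ⊎ ∃[ c ] ∃[ h ] c ≢ 0# × p ≈ scale c (toPoly h)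
  normalise []      = inj₁ ≈-refl
  normalise (a ∷ p) with normalise p
  ... | inj₂ (c , h , c≢0 , p≈ch) = inj₂ (c , c ⁻¹ * a ∷ h , c≢0 , ∷-cong (sym c[c⁻¹a]≡a) p≈ch)
    where
    c[c⁻¹a]≡a : c * (c ⁻¹ * a) ≡ a
    c[c⁻¹a]≡a = trans (sym (*-assoc c _ a)) (trans (cong (_* a) (inverseʳ c c≢0)) (*-identityˡ a))
  ... | inj₁ p≈[] with a ≟ 0#
  ...   | yes a≡0 = inj₁ (mk≈ λ { zero → a≡0 ; (suc i) → at p≈[] i })
  ...   | no  a≢0 = inj₂ (a , [] , a≢0 , ∷-cong (sym (*-identityʳ a)) p≈[])

  infix 4 _∣ₚ_
  record _∣ₚ_ (A B : Coeffs) : Set where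
    constructor divides
    field
      quotient : Coeffs
      equality : pmul A quotient ≈ B

  ∣ₚ-refl : ∀ A → A ∣ₚ A
  ∣ₚ-refl A = divides (1# ∷ []) (pmul-identityʳ A)

  ∣ₚ-respʳ : ∀ {A B B′} → B ≈ B′ → A ∣ₚ B → A ∣ₚ B′
  ∣ₚ-respʳ B≈B′ (divides Q AQ≈B) = divides Q (≈-trans AQ≈B B≈B′)

  ∣ₚ-pmul : ∀ {A B} X → A ∣ₚ B → A ∣ₚ pmul B X
  ∣ₚ-pmul {A} X (divides Q AQ≈B) = divides (pmul Q X) (≈-trans (≈-sym (pmul-assoc A Q X)) (pmul-congˡ X AQ≈B))

  ∣ₚ-trans : ∀ {A B D} → A ∣ₚ B → B ∣ₚ D → A ∣ₚ D
  ∣ₚ-trans A∣B (divides Q BQ≈D) = ∣ₚ-respʳ BQ≈D (∣ₚ-pmul Q A∣B)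

  ∣ₚ-padd : ∀ {A B B′} → A ∣ₚ B → A ∣ₚ B′ → A ∣ₚ padd B B′
  ∣ₚ-padd {A} (divides Q AQ≈B) (divides Q′ AQ′≈B′) =
    divides (padd Q Q′) (≈-trans (pmul-distribˡ A Q Q′) (padd-cong AQ≈B AQ′≈B′))

  ∣ₘ⇒∣ₚ : ∀ {f g} → f ∣ₘ g → toPoly f ∣ₚ toPoly g
  ∣ₘ⇒∣ₚ (h , fh≡g) = divides (toPoly h) (mk≈ λ i → cong (λ X → coef X i) fh≡g)

  ∣ₚ⇒∣ₘ : ∀ {f g} → toPoly f ∣ₚ toPoly g → f ∣ₘ g
  ∣ₚ⇒∣ₘ {f} {g} (divides Q fQ≈g) with normalise Q
  ... | inj₁ Q≈[] = ⊥-elim (toPoly≉[] g (≈-trans (≈-sym fQ≈g) (≈-trans (pmul-congʳ (toPoly f) Q≈[]) (pmul-zeroʳ (toPoly f)))))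
  ... | inj₂ (c , k , c≢0 , Q≈ck) with monic-pmul f k
  ...   | m , fk≡m , _ = k , trans fk≡m (cong toPoly (sym g≡m))
    where
    g≈cm : toPoly g ≈ scale c (toPoly m)
    g≈cm = begin
      toPoly g                          ≈⟨ fQ≈g ⟨
      pmul (toPoly f) Q                 ≈⟨ pmul-congʳ (toPoly f) Q≈ck ⟩
      pmul (toPoly f) (scale c (toPoly k)) ≈⟨ pmul-comm (toPoly f) _ ⟩
      pmul (scale c (toPoly k)) (toPoly f) ≈⟨ pmul-scaleˡ c (toPoly k) (toPoly f) ⟩
      scale c (pmul (toPoly k) (toPoly f)) ≈⟨ scale-cong c (pmul-comm (toPoly k) (toPoly f)) ⟩
      scale c (pmul (toPoly f) (toPoly k)) ≡⟨ cong (scale c) fk≡m ⟩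
      scale c (toPoly m)                ∎
      where open ≈-Reasoning
    g≡m : g ≡ m
    g≡m with toPoly≈scale-toPoly c≢0 g≈cm
    ... | _ , refl = toPoly-≈-injective (≈-trans g≈cm (scale-one (toPoly m)))

  ∣ₘ-refl : ∀ {f} → f ∣ₘ f
  ∣ₘ-refl {f} = ∣ₚ⇒∣ₘ (∣ₚ-refl (toPoly f))

  ∣ₘ-trans : ∀ {f g h} → f ∣ₘ g → g ∣ₘ h → f ∣ₘ h
  ∣ₘ-trans {f} {g} {h} f∣g g∣h = ∣ₚ⇒∣ₘ (∣ₚ-trans (∣ₘ⇒∣ₚ {f} {g} f∣g) (∣ₘ⇒∣ₚ {g} {h} g∣h))

  ∣ₘ-length : ∀ {f g} → ((h , _) : f ∣ₘ g) → length g ≡ length f ℕ.+ length h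
  ∣ₘ-length {f} {g} (h , fh≡g) with monic-pmul f h
  ... | c , fh≡c , length-c = trans (cong length (toPoly-injective (trans (sym fh≡g) fh≡c))) length-c

  ∣ₘ⇒length≤ : ∀ {f g} → f ∣ₘ g → length f ≤ length g
  ∣ₘ⇒length≤ {f} {g} f∣g = ℕ.≤-trans (ℕ.m≤m+n _ _) (ℕ.≤-reflexive (sym (∣ₘ-length {f} {g} f∣g)))

  ∣ₘ∧length≡⇒≡ : ∀ {f g} → f ∣ₘ g → length f ≡ length g → f ≡ g
  ∣ₘ∧length≡⇒≡ {f} ([] , f1≡g) _ = toPoly-≈-injective (≈-trans (≈-sym (pmul-identityʳ (toPoly f))) (mk≈ λ i → cong (λ X → coef X i) f1≡g))
  ∣ₘ∧length≡⇒≡ {f} {g} f∣g@(h ∷ _ , _) f≡g = ⊥-elim (ℕ.m+1+n≰m (length f) (ℕ.≤-reflexive (trans (sym (∣ₘ-length {f} {g} f∣g)) (sym f≡g))))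

  DegreeBelow : ℕ → Coeffs → Set
  DegreeBelow n B = ∀ {i} → n ≤ i → coef B i ≡ 0#

  shift : ℕ → Coeffs → Coeffs
  shift k X = replicate k 0# ++ X

  coef-shift : ∀ k X {i} → k ≤ i → coef (shift k X) i ≡ coef X (i ∸ k)
  coef-shift zero    X _         = refl
  coef-shift (suc k) X (s≤s k≤i) = coef-shift k X k≤i

  shift-cong : ∀ k {X Y} → X ≈ Y → shift k X ≈ shift k Y
  shift-cong zero    X≈Y = X≈Y
  shift-cong (suc k) X≈Y = ∷-cong refl (shift-cong k X≈Y)

  pmul-shift : ∀ k X Y → pmul X (shift k Y) ≈ shift k (pmul X Y)
  pmul-shift zero    X Y = ≈-refl
  pmul-shift (suc k) X Y = begin
    pmul X (0# ∷ shift k Y)                   ≈⟨ pmul-∷ʳ X 0# (shift k Y) ⟩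
    padd (scale 0# X) (0# ∷ pmul X (shift k Y)) ≈⟨ padd-cong (scale-zero X) (∷-cong refl (pmul-shift k X Y)) ⟩
    0# ∷ shift k (pmul X Y)                   ∎
    where open ≈-Reasoning

  padd-pneg-cancel : ∀ B M → B ≈ padd (padd B (pneg M)) M
  padd-pneg-cancel B M = begin
    B                         ≈⟨ padd-identityʳ B ⟨
    padd B []                 ≈⟨ padd-congˡ B (≈-trans (padd-comm (pneg M) M) (padd-pneg M)) ⟨
    padd B (padd (pneg M) M)  ≈⟨ padd-assoc B (pneg M) M ⟨
    padd (padd B (pneg M)) M  ∎
    where open ≈-Reasoning

  padd-quotient : ∀ {A B B′ Q Q′ R} → B′ ≈ padd (pmul A Q′) R → B ≈ padd B′ (pmul A Q) →
                  B ≈ padd (pmul A (padd Q′ Q)) R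
  padd-quotient {A} {B} {B′} {Q} {Q′} {R} B′≈AQ′+R B≈B′+AQ = begin
    B                                     ≈⟨ B≈B′+AQ ⟩
    padd B′ (pmul A Q)                    ≈⟨ padd-congʳ (pmul A Q) B′≈AQ′+R ⟩
    padd (padd (pmul A Q′) R) (pmul A Q)  ≈⟨ padd-xy∙z≈xz∙y (pmul A Q′) R (pmul A Q) ⟩
    padd (padd (pmul A Q′) (pmul A Q)) R  ≈⟨ padd-congʳ R (pmul-distribˡ A Q′ Q) ⟨
    padd (pmul A (padd Q′ Q)) R           ∎
    where open ≈-Reasoning

  -- Subtracting b·x^(m∸d)·D, where d = deg D and b is the coefficient of x^m in B, kills that coefficient.
  division-step : ∀ D {m} B → length D ≤ m → DegreeBelow (suc m) B →
                  DegreeBelow m (padd B (pneg (shift (m ∸ length D) (scale (coef B m) (toPoly D)))))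
  division-step D {m} B d≤m B<1+m {i} m≤i = begin
    coef (padd B (pneg M)) i          ≡⟨ coef-padd B (pneg M) i ⟩
    coef B i + coef (pneg M) i        ≡⟨ cong (coef B i +_) (trans (coef-scale (- 1#) M i) (-1*x≈-x _)) ⟩
    coef B i + - coef M i             ≡⟨ cong (λ x → coef B i + - x) (trans (coef-shift k _ k≤i) (coef-scale b (toPoly D) _)) ⟩
    coef B i + - (b * coef (toPoly D) (i ∸ k)) ≡⟨ top (ℕ.m≤n⇒m<n∨m≡n m≤i) ⟩
    0#                                ∎
    where
    open ≡-Reasoning
    d = length D
    k = m ∸ d
    b = coef B m
    M = shift k (scale b (toPoly D))
    k≤i = ℕ.≤-trans (ℕ.m∸n≤m m d) m≤i
    top : m < i ⊎ m ≡ i → coef B i + - (b * coef (toPoly D) (i ∸ k)) ≡ 0#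
    top (inj₂ refl) = begin
      b + - (b * coef (toPoly D) (m ∸ k))  ≡⟨ cong (λ j → b + - (b * coef (toPoly D) j)) (ℕ.m∸[m∸n]≡n d≤m) ⟩
      b + - (b * coef (toPoly D) d)        ≡⟨ cong (λ x → b + - (b * x)) (coef-toPoly-length D) ⟩
      b + - (b * 1#)                       ≡⟨ cong (λ x → b + - x) (*-identityʳ b) ⟩
      b + - b                              ≡⟨ -‿inverseʳ b ⟩
      0#                                   ∎
    top (inj₁ m<i) = begin
      coef B i + - (b * coef (toPoly D) (i ∸ k))  ≡⟨ cong₂ (λ x y → x + - (b * y)) (B<1+m m<i) (coef-toPoly-> D (m<i⇒d<i∸[m∸d] d≤m m<i)) ⟩
      0# + - (b * 0#)                             ≡⟨ cong (λ x → 0# + - x) (zeroʳ b) ⟩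
      0# + - 0#                                   ≡⟨ -‿inverseʳ 0# ⟩
      0#                                          ∎

  divide : ∀ D n B → DegreeBelow n B →
           ∃[ Q ] ∃[ R ] B ≈ padd (pmul (toPoly D) Q) R × DegreeBelow (length D) R
  divide D zero    B B<0 = [] , B , padd-congʳ B (≈-sym (pmul-zeroʳ (toPoly D))) , λ _ → B<0 z≤n
  divide D (suc m) B B<1+m with length D ℕ.≤? m
  ... | no  d≰m = [] , B , padd-congʳ B (≈-sym (pmul-zeroʳ (toPoly D))) , B<1+m ∘ ℕ.≤-trans (ℕ.≰⇒> d≰m)
  ... | yes d≤m = extend (divide D m (padd B (pneg M)) (division-step D B d≤m B<1+m))
    where
    k = m ∸ length D
    M = shift k (scale (coef B m) (toPoly D))
    M≈DQ₀ : M ≈ pmul (toPoly D) (shift k (coef B m ∷ []))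
    M≈DQ₀ = ≈-sym (≈-trans (pmul-shift k (toPoly D) _) (shift-cong k (pmul-[c]ʳ (coef B m) (toPoly D))))
    extend : ∃[ Q ] ∃[ R ] padd B (pneg M) ≈ padd (pmul (toPoly D) Q) R × DegreeBelow (length D) R →
             ∃[ Q ] ∃[ R ] B ≈ padd (pmul (toPoly D) Q) R × DegreeBelow (length D) R
    extend (Q′ , R , B′≈DQ′+R , R<d) =
      padd Q′ (shift k (coef B m ∷ [])) , R , padd-quotient {toPoly D} B′≈DQ′+R (≈-trans (padd-pneg-cancel B M) (padd-congˡ _ M≈DQ₀)) , R<d

  length-degree : ∀ p → DegreeBelow (length p) p
  length-degree []      _         = refl
  length-degree (a ∷ p) (s≤s p≤i) = length-degree p p≤i

  record Ideal (S : Coeffs → Set) : Set where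
    field
      ≈-closed    : ∀ {p q} → p ≈ q → S p → S q
      padd-closed : ∀ {p q} → S p → S q → S (padd p q)
      pmul-closed : ∀ {p} X → S p → S (pmul p X)

  module _ {S} (I : Ideal S) where
    open Ideal I

    remainder-closed : ∀ {A p Q R} → S A → S p → p ≈ padd (pmul A Q) R → S R
    remainder-closed {A} {p} {Q} {R} SA Sp p≈AQ+R =
      ≈-closed p-AQ≈R (padd-closed Sp (pmul-closed (- 1# ∷ []) (pmul-closed Q SA)))
      where
      p-AQ≈R : padd p (pmul (pmul A Q) (- 1# ∷ [])) ≈ R
      p-AQ≈R = begin
        padd p (pmul (pmul A Q) (- 1# ∷ []))        ≈⟨ padd-cong p≈AQ+R (pmul-[c]ʳ (- 1#) (pmul A Q)) ⟩
        padd (padd (pmul A Q) R) (pneg (pmul A Q))  ≈⟨ padd-xy∙z≈xz∙y (pmul A Q) R _ ⟩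
        padd (padd (pmul A Q) (pneg (pmul A Q))) R  ≈⟨ padd-congʳ R (padd-pneg (pmul A Q)) ⟩
        R                                           ∎
        where open ≈-Reasoning

    monic-closed : ∀ {R c k} → c ≢ 0# → R ≈ scale c (toPoly k) → S R → S (toPoly k)
    monic-closed {R} {c} {k} c≢0 R≈ck SR = ≈-closed c⁻¹R≈k (pmul-closed (c ⁻¹ ∷ []) SR)
      where
      c⁻¹R≈k : pmul R (c ⁻¹ ∷ []) ≈ toPoly k
      c⁻¹R≈k = begin
        pmul R (c ⁻¹ ∷ [])                ≈⟨ pmul-[c]ʳ (c ⁻¹) R ⟩
        scale (c ⁻¹) R                    ≈⟨ scale-cong (c ⁻¹) R≈ck ⟩
        scale (c ⁻¹) (scale c (toPoly k)) ≈⟨ scale-assoc (c ⁻¹) c (toPoly k) ⟩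
        scale (c ⁻¹ * c) (toPoly k)       ≡⟨ cong (λ x → scale x (toPoly k)) (inverseˡ c≢0) ⟩
        scale 1# (toPoly k)               ≈⟨ scale-one (toPoly k) ⟩
        toPoly k                          ∎
        where open ≈-Reasoning

    -- A monic element of least degree generates the ideal: the remainder of any element
    -- on division by it lies in the ideal and has smaller degree, so it vanishes.
    principal : ∀ {h} → S (toPoly h) → ¬ ¬ (∃[ D ] S (toPoly D) × (∀ {p} → S p → toPoly D ∣ₚ p))
    principal {h} Sh = do
      (_ , (D , refl , SD) , least) ← ¬¬-least MonicOfLength (h , refl , Sh)
      pure (D , SD , λ {p} → generates D SD least {p})
      where
      MonicOfLength : ℕ → Set
      MonicOfLength n = ∃[ h ] length h ≡ n × S (toPoly h)
      generates : ∀ D → S (toPoly D) → (∀ {k} → k < length D → ¬ MonicOfLength k) → ∀ {p} → S p → toPoly D ∣ₚ p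
      generates D SD least {p} Sp with divide D (length p) p (length-degree p)
      ... | Q , R , p≈DQ+R , R<D with normalise R
      ...   | inj₁ R≈[] = divides Q (≈-sym (≈-trans p≈DQ+R (≈-trans (padd-congˡ _ R≈[]) (padd-identityʳ _))))
      ...   | inj₂ (c , k , c≢0 , R≈ck) = ⊥-elim (least k<D (k , refl , monic-closed c≢0 R≈ck SR))
        where
        SR : S R
        SR = remainder-closed SD Sp p≈DQ+R
        coef-R-k : coef R (length k) ≡ c
        coef-R-k = trans (at R≈ck (length k)) (trans (coef-scale c (toPoly k) _) (trans (cong (c *_) (coef-toPoly-length k)) (*-identityʳ c)))
        k<D : length k < length D
        k<D = ℕ.≰⇒> (λ D≤k → c≢0 (trans (sym coef-R-k) (R<D D≤k)))

  lcm-exists : ∀ {r} {fs : Fin r → Monic} {f} → (∀ i → fs i ∣ₘ f) → ¬ ¬ (∃[ L ] IsLcm fs L)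
  lcm-exists {fs = fs} fs∣f = do
    (L , fs∣L , L∣multiples) ← principal common-multiples (λ i → ∣ₘ⇒∣ₚ (fs∣f i))
    pure (L , (λ i → ∣ₚ⇒∣ₘ (fs∣L i)) , λ M fs∣M → ∣ₚ⇒∣ₘ (L∣multiples (λ i → ∣ₘ⇒∣ₚ (fs∣M i))))
    where
    common-multiples : Ideal (λ X → ∀ i → toPoly (fs i) ∣ₚ X)
    common-multiples = record
      { ≈-closed    = λ X≈Y fs∣X i → ∣ₚ-respʳ X≈Y (fs∣X i)
      ; padd-closed = λ fs∣X fs∣Y i → ∣ₚ-padd (fs∣X i) (fs∣Y i)
      ; pmul-closed = λ Z fs∣X i → ∣ₚ-pmul Z (fs∣X i) }

  gcd-exists : ∀ a b → ¬ ¬ (∃[ G ] IsGcd a b G)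
  gcd-exists a b = do
    (G , (A , B , G≈aA+bB) , G∣combinations) ← principal combinations a-combination
    pure (G , ∣ₚ⇒∣ₘ (G∣combinations a-combination) , ∣ₚ⇒∣ₘ (G∣combinations b-combination) ,
          λ D D∣a D∣b → ∣ₚ⇒∣ₘ {D} {G} (∣ₚ-respʳ (≈-sym G≈aA+bB) (∣ₚ-padd (∣ₚ-pmul A (∣ₘ⇒∣ₚ {D} {a} D∣a)) (∣ₚ-pmul B (∣ₘ⇒∣ₚ {D} {b} D∣b)))))
    where
    Combination : Coeffs → Set
    Combination X = ∃[ A ] ∃[ B ] X ≈ padd (pmul (toPoly a) A) (pmul (toPoly b) B)
    combinations : Ideal Combination
    combinations = record
      { ≈-closed    = λ { X≈Y (A , B , X≈aA+bB) → A , B , ≈-trans (≈-sym X≈Y) X≈aA+bB }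
      ; padd-closed = λ { {X} {Y} (A , B , X≈) (A′ , B′ , Y≈) → padd A A′ , padd B B′ , (begin
            padd X Y
              ≈⟨ padd-cong X≈ Y≈ ⟩
            padd (padd (pmul (toPoly a) A) (pmul (toPoly b) B)) (padd (pmul (toPoly a) A′) (pmul (toPoly b) B′))
              ≈⟨ padd-interchange (pmul (toPoly a) A) (pmul (toPoly b) B) (pmul (toPoly a) A′) (pmul (toPoly b) B′) ⟩
            padd (padd (pmul (toPoly a) A) (pmul (toPoly a) A′)) (padd (pmul (toPoly b) B) (pmul (toPoly b) B′))
              ≈⟨ padd-cong (pmul-distribˡ (toPoly a) A A′) (pmul-distribˡ (toPoly b) B B′) ⟨
            padd (pmul (toPoly a) (padd A A′)) (pmul (toPoly b) (padd B B′))
              ∎) }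
      ; pmul-closed = λ { {X} Z (A , B , X≈) → pmul A Z , pmul B Z , (begin
            pmul X Z
              ≈⟨ pmul-congˡ Z X≈ ⟩
            pmul (padd (pmul (toPoly a) A) (pmul (toPoly b) B)) Z
              ≈⟨ pmul-distribʳ (pmul (toPoly a) A) (pmul (toPoly b) B) Z ⟩
            padd (pmul (pmul (toPoly a) A) Z) (pmul (pmul (toPoly b) B) Z)
              ≈⟨ padd-cong (pmul-assoc (toPoly a) A Z) (pmul-assoc (toPoly b) B Z) ⟩
            padd (pmul (toPoly a) (pmul A Z)) (pmul (toPoly b) (pmul B Z))
              ∎) } }
      where open ≈-Reasoning
    a-combination : Combination (toPoly a)
    a-combination = 1# ∷ [] , [] , ≈-sym (≈-trans (padd-cong (pmul-identityʳ (toPoly a)) (pmul-zeroʳ (toPoly b))) (padd-identityʳ (toPoly a)))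
    b-combination : Combination (toPoly b)
    b-combination = [] , 1# ∷ [] , ≈-sym (padd-cong (pmul-zeroʳ (toPoly a)) (pmul-identityʳ (toPoly b)))

  -- The ideal {X | a ∣ X·Y} contains a and P; its generator divides P without being P, so it is 1.
  ∣-cancel-irreducible : ∀ {P a} Y → Irreducible P → ¬ P ∣ₘ a → toPoly a ∣ₚ pmul (toPoly P) Y → ¬ ¬ (toPoly a ∣ₚ Y)
  ∣-cancel-irreducible {P} {a} Y (_ , P-irr) P∤a a∣PY = do
    (D , a∣DY , D∣multipliers) ← principal multipliers {a} (divides Y ≈-refl)
    case P-irr D (∣ₚ⇒∣ₘ (D∣multipliers a∣PY)) of λ where
      (inj₁ refl) → pure (∣ₚ-respʳ (pmul-identityˡ Y) a∣DY)
      (inj₂ refl) → λ _ → P∤a (∣ₚ⇒∣ₘ (D∣multipliers (divides Y ≈-refl)))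
    where
    multipliers : Ideal (λ X → toPoly a ∣ₚ pmul X Y)
    multipliers = record
      { ≈-closed    = λ X≈X′ → ∣ₚ-respʳ (pmul-congˡ Y X≈X′)
      ; padd-closed = λ {X} {X′} a∣XY a∣X′Y → ∣ₚ-respʳ (≈-sym (pmul-distribʳ X X′ Y)) (∣ₚ-padd a∣XY a∣X′Y)
      ; pmul-closed = λ {X} Z a∣XY → ∣ₚ-respʳ (begin
          pmul (pmul X Y) Z    ≈⟨ pmul-assoc X Y Z ⟩
          pmul X (pmul Y Z)    ≈⟨ pmul-congʳ X (pmul-comm Y Z) ⟩
          pmul X (pmul Z Y)    ≈⟨ pmul-assoc X Z Y ⟨
          pmul (pmul X Z) Y    ∎) (∣ₚ-pmul Z a∣XY) }
      where open ≈-Reasoning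

  cofactor∤ : ∀ {P L} → P ≢ one → ((L′ , _) : P ∣ₘ L) → ¬ L ∣ₘ L′
  cofactor∤ {[]}    P≢one _   _     = P≢one refl
  cofactor∤ {_ ∷ P} {L} _ P∣L@(L′ , _) L∣L′ = ℕ.<⇒≱ L′<L (∣ₘ⇒length≤ {L} {L′} L∣L′)
    where
    L′<L : length L′ < length L
    L′<L = ℕ.≤-trans (s≤s (ℕ.m≤n+m (length L′) (length P))) (ℕ.≤-reflexive (sym (∣ₘ-length {_ ∷ P} {L} P∣L)))

  -- If P ∤ fᵢ for all i, then fᵢ ∣ L/P for all i, so L ∣ L/P, which has smaller degree.
  irreducible∣lcm : ∀ {r} {fs : Fin r → Monic} {L P} → IsLcm fs L → Irreducible P → P ∣ₘ L →
                    ¬ ¬ (∃[ i ] P ∣ₘ fs i)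
  irreducible∣lcm {fs = fs} {L} {P} (fs∣L , L-least) P-irr P∣L@(L′ , PL′≡L) P∤fs = ¬¬-Π-Fin
    (λ i → ∣-cancel-irreducible (toPoly L′) P-irr (λ P∣fsᵢ → P∤fs (i , P∣fsᵢ)) (∣ₚ-respʳ (mk≈ λ j → cong (λ X → coef X j) (sym PL′≡L)) (∣ₘ⇒∣ₚ (fs∣L i))))
    (λ fs∣L′ → cofactor∤ (proj₁ P-irr) P∣L (L-least L′ (λ i → ∣ₚ⇒∣ₘ (fs∣L′ i))))

  -- A non-constant monic divisor of H of least degree is irreducible.
  irreducible-factor : ∀ {H} → H ≢ one → ¬ ¬ (∃[ P ] Irreducible P × P ∣ₘ H)
  irreducible-factor {H} H≢one = do
    (_ , (P , refl , P≢one , P∣H) , least) ← ¬¬-least NonConstantDivisor (H , refl , H≢one , ∣ₘ-refl)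
    pure (P , (P≢one , λ D D∣P → only-trivial-divisors P P∣H least D D∣P) , P∣H)
    where
    NonConstantDivisor : ℕ → Set
    NonConstantDivisor n = ∃[ P ] length P ≡ n × P ≢ one × P ∣ₘ H
    only-trivial-divisors : ∀ P → P ∣ₘ H → (∀ {k} → k < length P → ¬ NonConstantDivisor k) →
                            ∀ D → D ∣ₘ P → D ≡ one ⊎ D ≡ P
    only-trivial-divisors P P∣H least D D∣P with List.≡-dec _≟_ D one | List.≡-dec _≟_ D P
    ... | yes D≡one | _       = inj₁ D≡one
    ... | no  _     | yes D≡P = inj₂ D≡P
    ... | no  D≢one | no  D≢P = ⊥-elim (least D<P (D , refl , D≢one , ∣ₘ-trans {D} {P} {H} D∣P P∣H))
      where
      D<P : length D < length P
      D<P = ℕ.≤∧≢⇒< (∣ₘ⇒length≤ {D} {P} D∣P) (D≢P ∘ ∣ₘ∧length≡⇒≡ {D} {P} D∣P)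

  irreducible∣-via-lcm : ∀ {r} {fs : Fin r → Monic} {f} → (∀ i → fs i ∣ₘ f) →
                         (∀ L → IsLcm fs L → ∀ P → Irreducible P → (P ∣ₘ L ⇔ P ∣ₘ f)) →
                         ∀ {P} → Irreducible P → P ∣ₘ f → ¬ ¬ (∃[ i ] P ∣ₘ fs i)
  irreducible∣-via-lcm {fs = fs} fs∣f same-irreducibles {P} P-irr P∣f = do
    (L , L-lcm) ← lcm-exists {fs = fs} fs∣f
    irreducible∣lcm {fs = fs} {L} {P} L-lcm P-irr (Equivalence.from (same-irreducibles L L-lcm P P-irr) P∣f)

  irreducible∣-via-gcd : ∀ {a b c} → (∀ G → IsGcd a b G → ∀ P → Irreducible P → (P ∣ₘ G ⇔ P ∣ₘ c)) →
                         ∀ {P} → Irreducible P → P ∣ₘ c → ¬ ¬ (P ∣ₘ a)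
  irreducible∣-via-gcd {a} {b} same-irreducibles {P} P-irr P∣c = do
    (G , G-gcd@(G∣a , _)) ← gcd-exists a b
    pure (∣ₘ-trans {P} {G} {a} (Equivalence.from (same-irreducibles G G-gcd P P-irr) P∣c) G∣a)

-- Freeness

module Freeness {F E : FiniteField} (emb : Embedding F E) where
  open Embedding emb using (ι; ι-+; ι-*; ι-1)
  open FiniteField E hiding (card)
  open FieldProperties E using (+-identityˡ; +-identityʳ; *-identityʳ; zeroˡ; zeroʳ; *-assoc; distribˡ; distribʳ;
    +-cancelˡ; +-interchange; _≟_; _·_; ^-*-assoc; ^-distribʳ-*; 0^suc; prime-power-card⇒char)
  open Frobenius E using (frobenius-^)
  open Polynomials F using (Monic; toPoly; one; padd; pmul; scale; _∣ₘ_; Irreducible; ∣ₘ-trans; irreducible-factor)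
  open Free emb
  module F = FiniteField F

  ι-0 : ι F.0# ≡ 0#
  ι-0 = +-cancelˡ (ι F.0#) _ _ (begin
    ι F.0# + ι F.0#     ≡⟨ ι-+ F.0# F.0# ⟨
    ι (F.0# F.+ F.0#)   ≡⟨ cong ι (FieldProperties.+-identityʳ F F.0#) ⟩
    ι F.0#              ≡⟨ +-identityʳ _ ⟨
    ι F.0# + 0#         ∎)
    where open ≡-Reasoning

  ι-^ : ∀ a n → ι (a F.^ n) ≡ ι a ^ n
  ι-^ a zero    = ι-1
  ι-^ a (suc n) = trans (ι-* a _) (cong (ι a *_) (ι-^ a n))

  ι-fixed : ∀ a → ι a ^ q ≡ ι a
  ι-fixed a = trans (sym (ι-^ a q)) (cong ι (FieldProperties.fermat F a))

  q-frobenius : ∀ {n} → IsPrimePower q → card E ≡ q ℕ.^ n → ∀ x y → (x + y) ^ q ≡ x ^ q + y ^ q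
  q-frobenius {n} (p , k , p-prime , _ , q≡pᵏ) card-E x y =
    subst (λ e → (x + y) ^ e ≡ x ^ e + y ^ e) (sym q≡pᵏ) (frobenius-^ p-prime char k x y)
    where
    char : p · 1# ≡ 0#
    char = prime-power-card⇒char {p} {k ℕ.* n} (trans card-E (trans (cong (ℕ._^ n) q≡pᵏ) (ℕ.^-*-assoc p k n)))

  0^q : 0# ^ q ≡ 0#
  0^q rewrite FieldProperties.card≡1+|units| F = 0^suc (length (FieldProperties.units F))

  MFree⇒not-power : ∀ {m w p} → MFree m w → Prime p → p ∣ m → ∀ u → w ≢ u ^ p
  MFree⇒not-power m-free p-prime p∣m u w≡uᵖ = ¬prime[1] (subst Prime (m-free u _ p∣m w≡uᵖ) p-prime)

  not-power⇒MFree : ∀ {m w} → 0 < m → (∀ {p} → Prime p → p ∣ m → ∀ u → w ≢ u ^ p) → MFree m w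
  not-power⇒MFree {m} {w} 0<m no-power v d d∣m w≡vᵈ = decidable-stable (d ℕ.≟ 1) λ d≢1 →
    let (p , p-prime , p∣d@(divides c d≡c*p)) = prime-divisor (ℕ.≤∧≢⇒< (divisor-positive d∣m 0<m) (d≢1 ∘ sym))
    in no-power p-prime (∣-trans p∣d d∣m) (v ^ c) (begin
      w              ≡⟨ w≡vᵈ ⟩
      v ^ d          ≡⟨ cong (v ^_) d≡c*p ⟩
      v ^ (c ℕ.* p)  ≡⟨ ^-*-assoc v c p ⟨
      (v ^ c) ^ p    ∎)
    where open ≡-Reasoning

  MFree-from-family : ∀ {I : Set} {ms : I → ℕ} {m w} → 0 < m → (∀ {p} → Prime p → p ∣ m → ∃[ i ] p ∣ ms i) →
                      (∀ i → MFree (ms i) w) → MFree m w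
  MFree-from-family 0<m primes m-free = not-power⇒MFree 0<m λ p-prime p∣m →
    let (i , p∣mᵢ) = primes p-prime p∣m in MFree⇒not-power (m-free i) p-prime p∣mᵢ

  module WithFrobenius (frobenius : ∀ x y → (x + y) ^ q ≡ x ^ q + y ^ q) where

    σ-eval-suc : ∀ i X v → σ-eval (suc i) X v ≡ σ-eval i X v ^ q
    σ-eval-suc i []      v = sym 0^q
    σ-eval-suc i (a ∷ X) v = begin
      ι a * v ^ (q ℕ.* q ℕ.^ i) + σ-eval (suc (suc i)) X v
        ≡⟨ cong₂ _+_ (cong₂ _*_ (sym (ι-fixed a)) v^[q*qⁱ]≡[v^qⁱ]^q) (σ-eval-suc (suc i) X v) ⟩
      ι a ^ q * (v ^ (q ℕ.^ i)) ^ q + σ-eval (suc i) X v ^ q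
        ≡⟨ cong (_+ σ-eval (suc i) X v ^ q) (^-distribʳ-* (ι a) _ q) ⟨
      (ι a * v ^ (q ℕ.^ i)) ^ q + σ-eval (suc i) X v ^ q
        ≡⟨ frobenius _ _ ⟨
      (ι a * v ^ (q ℕ.^ i) + σ-eval (suc i) X v) ^ q
        ∎
      where
      open ≡-Reasoning
      v^[q*qⁱ]≡[v^qⁱ]^q : v ^ (q ℕ.* q ℕ.^ i) ≡ (v ^ (q ℕ.^ i)) ^ q
      v^[q*qⁱ]≡[v^qⁱ]^q = trans (cong (v ^_) (ℕ.*-comm q _)) (sym (^-*-assoc v (q ℕ.^ i) q))

    σ-eval-padd : ∀ i X Y v → σ-eval i (padd X Y) v ≡ σ-eval i X v + σ-eval i Y v
    σ-eval-padd i []      Y       v = sym (+-identityˡ _)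
    σ-eval-padd i (a ∷ X) []      v = sym (+-identityʳ _)
    σ-eval-padd i (a ∷ X) (b ∷ Y) v = begin
      ι (a F.+ b) * w + σ-eval (suc i) (padd X Y) v
        ≡⟨ cong₂ _+_ (trans (cong (_* w) (ι-+ a b)) (distribʳ w (ι a) (ι b))) (σ-eval-padd (suc i) X Y v) ⟩
      (ι a * w + ι b * w) + (σ-eval (suc i) X v + σ-eval (suc i) Y v)
        ≡⟨ +-interchange _ _ _ _ ⟩
      (ι a * w + σ-eval (suc i) X v) + (ι b * w + σ-eval (suc i) Y v)
        ∎
      where
      open ≡-Reasoning
      w = v ^ (q ℕ.^ i)

    σ-eval-scale : ∀ i c X v → σ-eval i (scale c X) v ≡ ι c * σ-eval i X v
    σ-eval-scale i c []      v = sym (zeroʳ _)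
    σ-eval-scale i c (a ∷ X) v = begin
      ι (c F.* a) * w + σ-eval (suc i) (scale c X) v
        ≡⟨ cong₂ _+_ (trans (cong (_* w) (ι-* c a)) (*-assoc (ι c) (ι a) w)) (σ-eval-scale (suc i) c X v) ⟩
      ι c * (ι a * w) + ι c * σ-eval (suc i) X v
        ≡⟨ distribˡ (ι c) _ _ ⟨
      ι c * (ι a * w + σ-eval (suc i) X v)
        ∎
      where
      open ≡-Reasoning
      w = v ^ (q ℕ.^ i)

    σ-eval-pmul : ∀ X Y v → σ-eval 0 (pmul X Y) v ≡ σ-eval 0 X (σ-eval 0 Y v)
    σ-eval-pmul []      Y v = refl
    σ-eval-pmul (a ∷ X) Y v = begin
      σ-eval 0 (padd (scale a Y) (F.0# ∷ pmul X Y)) v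
        ≡⟨ σ-eval-padd 0 (scale a Y) (F.0# ∷ pmul X Y) v ⟩
      σ-eval 0 (scale a Y) v + (ι F.0# * v ^ 1 + σ-eval 1 (pmul X Y) v)
        ≡⟨ cong₂ _+_ (σ-eval-scale 0 a Y v) (trans (cong (_+ σ-eval 1 (pmul X Y) v) (trans (cong (_* v ^ 1) ι-0) (zeroˡ _))) (+-identityˡ _)) ⟩
      ι a * u + σ-eval 1 (pmul X Y) v
        ≡⟨ cong (ι a * u +_) (trans (σ-eval-suc 0 (pmul X Y) v) (trans (cong (_^ q) (σ-eval-pmul X Y v)) (sym (σ-eval-suc 0 X u)))) ⟩
      ι a * u + σ-eval 1 X u
        ≡⟨ cong (λ t → ι a * t + σ-eval 1 X u) (*-identityʳ u) ⟨
      ι a * u ^ 1 + σ-eval 1 X u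
        ∎
      where
      open ≡-Reasoning
      u = σ-eval 0 Y v

    ˢ-pmul : ∀ {P R H} v → pmul (toPoly P) (toPoly R) ≡ toPoly H → H ˢ v ≡ P ˢ (R ˢ v)
    ˢ-pmul {P} {R} v PR≡H = trans (cong (λ X → σ-eval 0 X v) (sym PR≡H)) (σ-eval-pmul (toPoly P) (toPoly R) v)

    GFree⇒not-image : ∀ {g w P} → GFree g w → Irreducible P → P ∣ₘ g → ∀ u → w ≢ P ˢ u
    GFree⇒not-image g-free (P≢one , _) P∣g u w≡Pu = P≢one (g-free u _ P∣g w≡Pu)

    not-image⇒GFree : ∀ {g w} → (∀ {P} → Irreducible P → P ∣ₘ g → ∀ u → w ≢ P ˢ u) → GFree g w
    not-image⇒GFree {g} {w} no-image v H H∣g w≡Hv = decidable-stable (List.≡-dec (FieldProperties._≟_ F) H one) λ H≢one →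
      irreducible-factor H≢one λ (P , P-irr , P∣H@(R , PR≡H)) →
        no-image P-irr (∣ₘ-trans {P} {H} {g} P∣H H∣g) (R ˢ v) (trans w≡Hv (ˢ-pmul {P} {R} {H} v PR≡H))

    GFree-from-family : ∀ {I : Set} {gs : I → Monic} {g w} → (∀ {P} → Irreducible P → P ∣ₘ g → ¬ ¬ (∃[ i ] P ∣ₘ gs i)) →
                        (∀ i → GFree (gs i) w) → GFree g w
    GFree-from-family irreducibles g-free = not-image⇒GFree λ P-irr P∣g u w≡Pu →
      irreducibles P-irr P∣g λ (i , P∣gᵢ) → GFree⇒not-image (g-free i) P-irr P∣gᵢ u w≡Pu

    Good-from-family : ∀ {I : Set} (ms : I → ℕ) (fs gs : I → Monic) {m f g} → 0 < m →
                       (∀ {p} → Prime p → p ∣ m → ∃[ i ] p ∣ ms i) →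
                       (∀ {P} → Irreducible P → P ∣ₘ f → ¬ ¬ (∃[ i ] P ∣ₘ fs i)) →
                       (∀ {P} → Irreducible P → P ∣ₘ g → ¬ ¬ (∃[ i ] P ∣ₘ gs i)) →
                       ∀ {w} → w ≢ 0# → (∀ i → Good (ms i) (fs i) (gs i) w) → Good m f g w
    Good-from-family ms fs gs 0<m primes irreducibles-f irreducibles-g w≢0 good =
      w≢0 ,
      MFree-from-family 0<m primes (proj₁ ∘ proj₂ ∘ good) ,
      GFree-from-family irreducibles-f (proj₁ ∘ proj₂ ∘ proj₂ ∘ good) ,
      GFree-from-family irreducibles-g (proj₂ ∘ proj₂ ∘ proj₂ ∘ good)

  IsCount-sieve : ∀ {r} {P P₀ : Carrier → Set} {Ps : Fin r → Carrier → Set} {N N₀ Ns} →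
                  IsCount P N → IsCount P₀ N₀ → (∀ i → IsCount (Ps i) (Ns i)) →
                  (∀ {x} → (∀ i → Ps i x) → P x) → (∀ {i j} → i ≢ j → ∀ {x} → Ps i x → P₀ x) →
                  sumᶠ Ns ℤ.- ℤ.+ (r ∸ 1) ℤ.* ℤ.+ N₀ ℤ.≤ ℤ.+ N
  IsCount-sieve {r} {Ps = Ps} {Ns = Ns} (L , L-unique , L⇔P , refl) (L₀ , L₀-unique , L₀⇔P₀ , refl) counts ⋂Ps⊆P Ps⊆P₀ = begin
    sumᶠ Ns ℤ.- ℤ.+ (r ∸ 1) ℤ.* ℤ.+ length L₀  ≡⟨ cong₂ ℤ._-_ (Sieve.sumᶠ≡+sum Ns) (sym (ℤ.pos-* (r ∸ 1) _)) ⟩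
    ℤ.+ sum Ns ℤ.- ℤ.+ ((r ∸ 1) ℕ.* length L₀)  ≤⟨ m≤n+o⇒+m-+o≤+n (subst (_≤ _) (sum-cong-≗ (proj₂ ∘ proj₂ ∘ proj₂ ∘ counts)) bound) ⟩
    ℤ.+ length L                                ∎
    where
    open ℤ.≤-Reasoning
    open import Algebra.Properties.Semiring.Sum ℕ.+-*-semiring using (sum; sum-cong-≗)
    Ls : Fin r → List Carrier
    Ls = proj₁ ∘ counts
    member : ∀ i {x} → x ∈ Ls i → Ps i x
    member i = Equivalence.to (proj₁ (proj₂ (proj₂ (counts i))) _)
    bound : sum (length ∘ Ls) ≤ length L ℕ.+ (r ∸ 1) ℕ.* length L₀
    bound = Sieve.sieve-length _≟_ L L₀ Ls
      (λ x∈Ls → Equivalence.from (L⇔P _) (⋂Ps⊆P (λ i → member i (x∈Ls i))))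
      (λ i≢j x∈Lsᵢ → Equivalence.from (L₀⇔P₀ _) (Ps⊆P₀ i≢j (member _ x∈Lsᵢ)))
      elements-unique elements-complete L-unique L₀-unique (proj₁ ∘ proj₂ ∘ counts)

open import Data.Nat using (_^_; _*_)
open import Data.Integer using (+_; _-_; _≥_) renaming (_*_ to _*ℤ_)

proposition4p1 :
    (F E : FiniteField) (emb : Embedding F E) (n : ℕ) → 1 ≤ n →
    IsPrimePower (card F) → card E ≡ card F ^ n →
    let open Poly F
        open Free emb
    in
    (K Q : ℕ) → K * ((q ∸ 1) * gcd n (q ∸ 1)) ≡ q ^ n ∸ 1 → IsRadical Q K →
    (m : ℕ) → 0 < m → m ∣ Q →
    (f g : Monic) → f ∣ₘ xⁿ-1 n → g ∣ₘ xⁿ-1 n →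
    (r : ℕ) → 1 ≤ r →
    (ms : Fin r → ℕ) (fs gs : Fin r → Monic) →
    (∀ i → ms i ∣ m) → (∀ i → fs i ∣ₘ f) → (∀ i → gs i ∣ₘ g) →
    (m₀ : ℕ) (f₀ g₀ : Monic) → m₀ ∣ m → f₀ ∣ₘ f → g₀ ∣ₘ g →
    (∀ p → Prime p → (p ∣ lcmᶠ ms ⇔ p ∣ m)) →
    (∀ L → IsLcm fs L → ∀ P → Irreducible P → (P ∣ₘ L ⇔ P ∣ₘ f)) →
    (∀ L → IsLcm gs L → ∀ P → Irreducible P → (P ∣ₘ L ⇔ P ∣ₘ g)) →
    (∀ i j → i ≢ j → ∀ p → Prime p → (p ∣ gcd (ms i) (ms j) ⇔ p ∣ m₀)) →
    (∀ i j → i ≢ j → ∀ G → IsGcd (fs i) (fs j) G →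
       ∀ P → Irreducible P → (P ∣ₘ G ⇔ P ∣ₘ f₀)) →
    (∀ i j → i ≢ j → ∀ G → IsGcd (gs i) (gs j) G →
       ∀ P → Irreducible P → (P ∣ₘ G ⇔ P ∣ₘ g₀)) →
    (N : ℕ) (Ns : Fin r → ℕ) (N₀ : ℕ) →
    IsCount (Good m f g) N →
    (∀ i → IsCount (Good (ms i) (fs i) (gs i)) (Ns i)) →
    IsCount (Good m₀ f₀ g₀) N₀ →
    + N ≥ sumᶠ Ns - (+ (r ∸ 1)) *ℤ (+ N₀)
proposition4p1 F E emb n _ q-prime-power card-E _ _ _ _ m 0<m _ f g _ _ r 1≤r ms fs gs _ fs∣f gs∣g
               m₀ f₀ g₀ m₀∣m _ _ lcm-ms lcm-fs lcm-gs gcd-ms gcd-fs gcd-gs _ _ _ count countᵢ count₀ =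
  IsCount-sieve count count₀ countᵢ ⋂Good⊆Good Goodᵢ⊆Good₀
  where
  open Polynomials F using (irreducible∣-via-lcm; irreducible∣-via-gcd)
  open Free emb using (Good)
  open Freeness emb
  open WithFrobenius (q-frobenius {n} q-prime-power card-E)

  ⋂Good⊆Good : ∀ {w} → (∀ i → Good (ms i) (fs i) (gs i) w) → Good m f g w
  ⋂Good⊆Good good = Good-from-family ms fs gs 0<m
    (λ p-prime p∣m → prime∣lcmᶠ ms p-prime (Equivalence.from (lcm-ms _ p-prime) p∣m))
    (irreducible∣-via-lcm fs∣f lcm-fs) (irreducible∣-via-lcm gs∣g lcm-gs)
    (proj₁ (good (Fin.fromℕ< 1≤r))) good

  Goodᵢ⊆Good₀ : ∀ {i j} → i ≢ j → ∀ {w} → Good (ms i) (fs i) (gs i) w → Good m₀ f₀ g₀ w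
  Goodᵢ⊆Good₀ {i} {j} i≢j good = Good-from-family {I = ⊤} (λ _ → ms i) (λ _ → fs i) (λ _ → gs i)
    (divisor-positive m₀∣m 0<m)
    (λ p-prime p∣m₀ → tt , ∣-trans (Equivalence.from (gcd-ms i j i≢j _ p-prime) p∣m₀) (gcd[m,n]∣m _ _))
    (λ P-irr P∣f₀ → ¬¬-map (tt ,_) (irreducible∣-via-gcd (gcd-fs i j i≢j) P-irr P∣f₀))
    (λ P-irr P∣g₀ → ¬¬-map (tt ,_) (irreducible∣-via-gcd (gcd-gs i j i≢j) P-irr P∣g₀))
    (proj₁ good) (λ _ → good)
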